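{- Consider the following online algorithm in the static $F$ setting, with parameters an integer $\ell\ge1$, a small enough $\epsilon>0$ and $\gamma>0$, and suppose $z\ge 1$. Initially $S\subseteq F$ is an arbitrary set of $k$ medians, $C=\emptyset$, and $p=\min\{\frac{1}{10\gamma z},0.1\}$. At each time $t=1,\dots,n$: add the arriving point $j_t$ to $C$; then (loop) while there exists an $\ell$-swap $(A^*,A)$ on $S$ with $\mathsf{cost}_p(S\cup A^*\setminus A)<\mathsf{cost}_p(S)-|A|\cdot\frac{\epsilon\,\mathsf{cost}_p(S)}{k}$, perform it; afterwards, if more than $\frac{1}{1-\epsilon}(1+\frac1\ell)(1+\gamma)z$ points $j\in C$ satisfy $d_p(j,S)=p$, set $p\gets 2p$ and return to the loop; otherwise proceed to the next time step. Then at every moment of this algorithm, $$p\le\frac{2(3\ell+2)\,\mathsf{opt}}{\gamma(\ell+1)z},$$ where $\mathsf{opt}$ is the optimum value of the $k$-median with outliers instance formed by the current point set $C$.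
   Context: $F$ is a fixed set of potential medians, points of $C$ arrive online, $d$ is a metric on $F\cup C$ with integer distances, and $k$, $z$ are given integers. For $p\ge0$, $d_p(u,v)=\min\{d(u,v),p\}$ and $d_p(j,S)=\min_{i\in S}d_p(j,i)$. By convention an additive $0.1$ is included in all costs: $\mathsf{cost}_p(S)=0.1+\sum_{j\in C}d_p(j,S)$ and $\mathsf{opt}=0.1+\min_{S\subseteq F,|S|=k}\min_{O\subseteq C,|O|=z}\sum_{j\in C\setminus O}d(j,S)$ (equivalently, the instance contains an extra point and median at distance $0.1$ from each other and at infinite distance from everything else). An $\ell$-swap on $S$ ($|S|=k$) is a pair $(A^*,A)$ with $A\subseteq S$, $A^*\subseteq F\setminus S$, $|A|=|A^*|\le\ell$; applying it replaces $S$ by $S\cup A^*\setminus A$. -}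

module Defs where

open import Data.Nat as ℕ using (ℕ; zero; suc; NonZero; _<ᵇ_)
open import Data.Integer using (+_)
open import Data.Fin using (Fin; toℕ)
open import Data.Fin.Subset using (Subset; _∈_; _⊆_; _∪_; _∩_; ∁; _─_; ∣_∣)
open import Data.Rational as ℚ using (ℚ; 0ℚ; 1ℚ; _+_; _*_; _-_; _⊓_; _/_; _≤_; _<_; 1/_)
open import Data.Rational.Properties using (_≟_)
open import Data.Bool using (Bool; true; false; if_then_else_; _∧_)
open import Data.List using (List; foldr; allFin)
open import Data.Vec using (lookup; tabulate)
open import Data.Sum using (_⊎_; inj₁; inj₂)
open import Data.Product using (Σ; _×_; _,_; ∃)
open import Relation.Nullary using (¬_; yes; no)
open import Relation.Nullary.Decidable using (⌊_⌋)
open import Relation.Binary.PropositionalEquality using (_≡_)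
open import Relation.Binary.Construct.Closure.ReflexiveTransitive using (Star)

ℕ→ℚ : ℕ → ℚ
ℕ→ℚ n = (+ n) / 1

tenth : ℚ
tenth = (+ 1) / 10

-- total reciprocal (1/q for q ≠ 0; 0 for q = 0).  Only ever applied to
-- nonzero arguments in the statement below.
inv : ℚ → ℚ
inv q with q ≟ 0ℚ
... | yes _  = 0ℚ
... | no q≢0 = 1/_ q {{ℚ.≢-nonZero q≢0}}

_÷′_ : ℚ → ℚ → ℚ
p ÷′ q = p * inv q

-- Instances: medians F = Fin m, points Fin n (point j arrives at time
-- toℕ j + 1), an ℕ-valued (pseudo)metric d on F ⊎ points.

Point : ℕ → ℕ → Set
Point m n = Fin m ⊎ Fin n

record IsPseudometric {m n : ℕ} (d : Point m n → Point m n → ℕ) : Set where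
  field
    refl0 : ∀ u → d u u ≡ 0
    sym   : ∀ u v → d u v ≡ d v u
    tri   : ∀ u v w → d u w ℕ.≤ d u v ℕ.+ d v w

module Instance {m n : ℕ} (d : Point m n → Point m n → ℕ) where

  dist : Fin n → Fin m → ℕ
  dist j i = d (inj₂ j) (inj₁ i)

  Cset : ℕ → Subset n
  Cset t = tabulate (λ j → toℕ j <ᵇ t)

  sumOver : Subset n → (Fin n → ℚ) → ℚ
  sumOver X f = foldr (λ j acc → (if lookup X j then f j else 0ℚ) + acc) 0ℚ (allFin n)

  countOver : Subset n → (Fin n → Bool) → ℕ
  countOver X P = foldr (λ j acc → (if lookup X j ∧ P j then 1 else 0) ℕ.+ acc) 0 (allFin n)

  -- d_p(j,S) = min_{i∈S} min{d(j,i), p}  (the fold starts at p, which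
  -- accounts for the extra median at infinite distance; for nonempty S
  -- this is exactly min_{i∈S} d_p(j,i))
  dₚ : ℚ → Fin n → Subset m → ℚ
  dₚ p j S = foldr (λ i acc → if lookup S i then (ℕ→ℚ (dist j i) ⊓ p) ⊓ acc else acc) p (allFin m)

  costₚ : ℕ → ℚ → Subset m → ℚ
  costₚ t p S = tenth + sumOver (Cset t) (λ j → dₚ p j S)

  -- d(j,S) = min_{i∈S} d(j,i)  (the fold starts at max_{i∈F} d(j,i), so
  -- for nonempty S this is exactly the minimum over S)
  maxDist : Fin n → ℕ
  maxDist j = foldr (λ i acc → dist j i ℕ.⊔ acc) 0 (allFin m)

  distSet : Fin n → Subset m → ℕ
  distSet j S = foldr (λ i acc → if lookup S i then dist j i ℕ.⊓ acc else acc) (maxDist j) (allFin m)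

  outlierCost : ℕ → Subset m → Subset n → ℚ
  outlierCost t S O = tenth + sumOver (Cset t ─ O) (λ j → ℕ→ℚ (distSet j S))

  Feasible : ℕ → ℕ → ℕ → Subset m → Subset n → Set
  Feasible k z t S O = (∣ S ∣ ≡ k) × (O ⊆ Cset t) × (∣ O ∣ ℕ.≤ z)

  IsOpt : ℕ → ℕ → ℕ → ℚ → Set
  IsOpt k z t v =
    (∃ λ S → ∃ λ O → Feasible k z t S O × (v ≡ outlierCost t S O)) ×
    (∀ S O → Feasible k z t S O → v ≤ outlierCost t S O)

  IsSwap : ℕ → Subset m → Subset m → Subset m → Set
  IsSwap ℓ S A* A = (A ⊆ S) × (A* ⊆ ∁ S) × (∣ A ∣ ≡ ∣ A* ∣) × (∣ A ∣ ℕ.≤ ℓ)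

  applySwap : Subset m → Subset m → Subset m → Subset m
  applySwap S A* A = (S ∪ A*) ─ A

  Improving : ℕ → ℚ → ℕ → ℚ → Subset m → Subset m → Subset m → Set
  Improving k ε t p S A* A =
    costₚ t p (applySwap S A* A) < costₚ t p S - (ℕ→ℚ ∣ A ∣ * ((ε * costₚ t p S) ÷′ ℕ→ℚ k))

  farCount : ℕ → ℚ → Subset m → ℕ
  farCount t p S = countOver (Cset t) (λ j → ⌊ dₚ p j S ≟ p ⌋)

  threshold : ℕ → ℚ → ℚ → ℕ → ℚ
  threshold ℓ ε γ z = inv (1ℚ - ε) * ((1ℚ + inv (ℕ→ℚ ℓ)) * ((1ℚ + γ) * ℕ→ℚ z))

  p₀ : ℚ → ℕ → ℚ
  p₀ γ z = inv (ℕ→ℚ 10 * γ * ℕ→ℚ z) ⊓ tenth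

  -- Algorithm states.  'waiting': time step t is finished (or t = 0);
  -- 'looping': inside time step t, in the swap/double loop.
  data Phase : Set where
    waiting looping : Phase

  record State : Set where
    constructor state
    field
      time  : ℕ
      sol   : Subset m
      p     : ℚ
      phase : Phase
  open State public

  module Algorithm (k z ℓ : ℕ) (ε γ : ℚ) where

    NoImprovingSwap : ℕ → ℚ → Subset m → Set
    NoImprovingSwap t p S = ¬ (∃ λ A* → ∃ λ A → IsSwap ℓ S A* A × Improving k ε t p S A* A)

    TooManyFar : ℕ → ℚ → Subset m → Set
    TooManyFar t p S = threshold ℓ ε γ z < ℕ→ℚ (farCount t p S)

    Step : State → State → Set
    Step s s′ =
      -- point j_{t+1} arrives and is added to C (start of time step t+1)
      ( phase s ≡ waiting × phase s′ ≡ looping × time s ℕ.< n ×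
        time s′ ≡ suc (time s) × sol s′ ≡ sol s × p s′ ≡ p s )
      ⊎
      ( phase s ≡ looping × phase s′ ≡ looping × time s′ ≡ time s × p s′ ≡ p s ×
        (∃ λ A* → ∃ λ A → IsSwap ℓ (sol s) A* A × Improving k ε (time s) (p s) (sol s) A* A ×
                           sol s′ ≡ applySwap (sol s) A* A) )
      ⊎
      ( phase s ≡ looping × phase s′ ≡ looping × time s′ ≡ time s × sol s′ ≡ sol s ×
        NoImprovingSwap (time s) (p s) (sol s) × TooManyFar (time s) (p s) (sol s) ×
        p s′ ≡ p s + p s )
      ⊎
      ( phase s ≡ looping × phase s′ ≡ waiting × time s′ ≡ time s × sol s′ ≡ sol s ×
        NoImprovingSwap (time s) (p s) (sol s) × ¬ TooManyFar (time s) (p s) (sol s) ×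
        p s′ ≡ p s )

    Initial : State → Set
    Initial st = (time st ≡ 0) × (∣ sol st ∣ ≡ k) × (p st ≡ p₀ γ z) × (phase st ≡ waiting)

    Reachable : State → Set
    Reachable st = ∃ λ st₀ → Initial st₀ × Star Step st₀ st

module Submission where

-- Every state of a run satisfies p · γ(ℓ+1)z ≤ 2(3ℓ+2) · cost(S′, O) for every feasible solution
-- (S′, O) of the current instance, in particular for an optimal one.  Initially this holds because
-- p ≤ 1/(10γz) and every cost is at least 0.1; an arrival only adds solutions whose restriction to
-- the old points is no more expensive; swaps do not change p.  Doubling p is justified by the
-- swap argument of Arya et al.: S′ determines a weighted family of ℓ-swaps of S in which every
-- median of S′ ∖ S enters with total weight 1, every median of S leaves with total weight at most
-- 1 + 1/ℓ, and the weighted number of removed medians is at most k.  Averaging the inequalities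
-- "no swap improves cost_p(S)" over this family gives
--   (1 − ε) cost_p(S) ≤ (1 + 1/ℓ) p z + (3 + 2/ℓ) cost(S′, O),
-- while more than (1 + 1/ℓ)(1 + γ)z/(1 − ε) points at distance p from S force
-- (1 − ε) cost_p(S) ≥ (1 + 1/ℓ)(1 + γ) z p.  Together, (ℓ + 1)γzp ≤ (3ℓ + 2) cost(S′, O).

module Analysis where

  open import Data.Bool.Base using (Bool; true; false; if_then_else_; _∧_; _∨_; not)
  import Data.Bool.Properties as Boolₚ
  open import Data.Empty using (⊥-elim)
  open import Data.Fin.Base using (Fin; zero; suc; toℕ)
  import Data.Fin.Properties as Finₚ
  import Data.Integer.Base as ℤ
  import Data.Integer.Properties as ℤₚ
  import Data.List.Base as List
  open import Data.List.Extrema.Nat using (argmin; argmin-all; f[argmin]≤f[xs])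
  import Data.List.Relation.Unary.All as All
  open import Data.List.Relation.Unary.All.Properties using (all-filter)
  open import Data.List.Membership.Propositional.Properties using (∈-filter⁺; ∈-allFin)
  open import Data.Nat.Base as ℕ using (ℕ; zero; suc; z≤n; s≤s)
  import Data.Nat.Properties as ℕₚ
  import Data.Nat.Coprimality as Coprime
  open import Data.Product using (Σ; Σ-syntax; _×_; _,_; proj₁; proj₂; uncurry)
  open import Data.Sum using (_⊎_; inj₁; inj₂)
  open import Data.Rational.Base using (ℚ; mkℚ; 0ℚ; 1ℚ; _+_; _*_; _-_; -_; _⊓_; _≤_; _<_; positive; nonNegative; *<*; ≢-nonZero)
  open import Data.Rational.Properties
  import Data.Rational.Unnormalised.Base as ℚᵘ
  import Data.Rational.Unnormalised.Properties as ℚᵘₚ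
  open import Data.Rational.Solver using (module +-*-Solver)
  open import Data.Fin.Subset using (Subset; _∈_; _⊆_; _∪_; _∩_; ∁; _─_; ∣_∣)
  open import Data.Fin.Subset.Properties using (p∩q⊆q; ∣p∩q∣≤∣p∣)
  open import Data.Vec.Base using ([]; _∷_; lookup; tabulate)
  import Data.Vec.Properties as Vecₚ
  import Data.Vec.Functional as Vector
  open import Relation.Nullary using (¬_; yes; no)
  open import Relation.Nullary.Decidable using (⌊_⌋)
  open import Relation.Unary using (Decidable)
  open import Relation.Binary.PropositionalEquality
  open import Relation.Binary.Construct.Closure.ReflexiveTransitive as Star using (Star; _◅_)
  open import Defs

  open +-*-Solver using (solve; _:+_; _:*_; _:-_; :-_; _:=_; con)

  private
    variable
      A B : Set
      M N : ℕ

  private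
    open ℤ using () renaming (+_ to pos)

    mkℕ : ℕ → ℚ
    mkℕ n = mkℚ (pos n) 0 (Coprime.sym (Coprime.1-coprimeTo n))

    toMkℕ : ∀ n → ℕ→ℚ n ≡ mkℕ n
    toMkℕ n = ↥p/↧p≡p (mkℕ n)

    pos-+-normal : ∀ x y → ((pos x ℤ.* pos 1) ℤ.+ (pos y ℤ.* pos 1)) ℤ.* pos 1 ≡ pos (x ℕ.+ y) ℤ.* (pos 1 ℤ.* pos 1)
    pos-+-normal x y rewrite ℤₚ.*-identityʳ (pos x) | ℤₚ.*-identityʳ (pos y) | ℤₚ.*-identityʳ (pos x ℤ.+ pos y) = ℤₚ.pos-+ x y

    pos-*-normal : ∀ x y → (pos x ℤ.* pos y) ℤ.* pos 1 ≡ pos (x ℕ.* y) ℤ.* (pos 1 ℤ.* pos 1)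
    pos-*-normal x y rewrite ℤₚ.*-identityʳ (pos x ℤ.* pos y) | ℤₚ.*-identityʳ (pos (x ℕ.* y)) = sym (ℤₚ.pos-* x y)

  0<1 : 0ℚ < 1ℚ
  0<1 = *<* (ℤ.+<+ (s≤s z≤n))

  ℕ→ℚ-+ : ∀ x y → ℕ→ℚ (x ℕ.+ y) ≡ ℕ→ℚ x + ℕ→ℚ y
  ℕ→ℚ-+ x y rewrite toMkℕ (x ℕ.+ y) | toMkℕ x | toMkℕ y =
    toℚᵘ-injective (ℚᵘₚ.≃-sym (ℚᵘₚ.≃-trans (toℚᵘ-homo-+ (mkℕ x) (mkℕ y)) (ℚᵘ.*≡* (pos-+-normal x y))))

  ℕ→ℚ-* : ∀ x y → ℕ→ℚ (x ℕ.* y) ≡ ℕ→ℚ x * ℕ→ℚ y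
  ℕ→ℚ-* x y rewrite toMkℕ (x ℕ.* y) | toMkℕ x | toMkℕ y =
    toℚᵘ-injective (ℚᵘₚ.≃-sym (ℚᵘₚ.≃-trans (toℚᵘ-homo-* (mkℕ x) (mkℕ y)) (ℚᵘ.*≡* (pos-*-normal x y))))

  ℕ→ℚ-nonNeg : ∀ x → 0ℚ ≤ ℕ→ℚ x
  ℕ→ℚ-nonNeg x = nonNegative⁻¹ (ℕ→ℚ x) {{normalize-nonNeg x 1}}

  ℕ→ℚ-mono-≤ : ∀ {x y} → x ℕ.≤ y → ℕ→ℚ x ≤ ℕ→ℚ y
  ℕ→ℚ-mono-≤ {x} {y} x≤y = begin
    ℕ→ℚ x                  ≡⟨ +-identityʳ (ℕ→ℚ x) ⟨
    ℕ→ℚ x + 0ℚ             ≤⟨ +-monoʳ-≤ (ℕ→ℚ x) (ℕ→ℚ-nonNeg (y ℕ.∸ x)) ⟩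
    ℕ→ℚ x + ℕ→ℚ (y ℕ.∸ x) ≡⟨ ℕ→ℚ-+ x (y ℕ.∸ x) ⟨
    ℕ→ℚ (x ℕ.+ (y ℕ.∸ x)) ≡⟨ cong ℕ→ℚ (ℕₚ.m+[n∸m]≡n x≤y) ⟩
    ℕ→ℚ y                  ∎
    where open ≤-Reasoning

  ℕ→ℚ-mono-< : ∀ {x y} → x ℕ.< y → ℕ→ℚ x < ℕ→ℚ y
  ℕ→ℚ-mono-< {x} {y} x<y = begin-strict
    ℕ→ℚ x          ≡⟨ +-identityˡ (ℕ→ℚ x) ⟨
    0ℚ + ℕ→ℚ x     <⟨ +-monoˡ-< (ℕ→ℚ x) 0<1 ⟩
    1ℚ + ℕ→ℚ x     ≡⟨ ℕ→ℚ-+ 1 x ⟨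
    ℕ→ℚ (suc x)    ≤⟨ ℕ→ℚ-mono-≤ x<y ⟩
    ℕ→ℚ y          ∎
    where open ≤-Reasoning

  ℕ→ℚ-pos : ∀ {x} → 1 ℕ.≤ x → 0ℚ < ℕ→ℚ x
  ℕ→ℚ-pos = ℕ→ℚ-mono-<

  ℕ→ℚ-cancel-≤ : ∀ {x y} → ℕ→ℚ x ≤ ℕ→ℚ y → x ℕ.≤ y
  ℕ→ℚ-cancel-≤ x≤y = ℕₚ.≮⇒≥ (λ y<x → <-irrefl refl (<-≤-trans (ℕ→ℚ-mono-< y<x) x≤y))

  ℕ→ℚ-injective : ∀ {x y} → ℕ→ℚ x ≡ ℕ→ℚ y → x ≡ y
  ℕ→ℚ-injective x≡y = ℕₚ.≤-antisym (ℕ→ℚ-cancel-≤ (≤-reflexive x≡y)) (ℕ→ℚ-cancel-≤ (≤-reflexive (sym x≡y)))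

  ℕ→ℚ-∸ : ∀ {x y} → y ℕ.≤ x → ℕ→ℚ (x ℕ.∸ y) ≡ ℕ→ℚ x - ℕ→ℚ y
  ℕ→ℚ-∸ {x} {y} y≤x = begin
    ℕ→ℚ (x ℕ.∸ y)                     ≡⟨ solve 2 (λ u v → u := (u :+ v) :- v) refl (ℕ→ℚ (x ℕ.∸ y)) (ℕ→ℚ y) ⟩
    (ℕ→ℚ (x ℕ.∸ y) + ℕ→ℚ y) - ℕ→ℚ y  ≡⟨ cong (_- ℕ→ℚ y) (ℕ→ℚ-+ (x ℕ.∸ y) y) ⟨
    ℕ→ℚ (x ℕ.∸ y ℕ.+ y) - ℕ→ℚ y       ≡⟨ cong (λ w → ℕ→ℚ w - ℕ→ℚ y) (ℕₚ.m∸n+n≡m y≤x) ⟩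
    ℕ→ℚ x - ℕ→ℚ y                     ∎
    where open ≡-Reasoning

  tenth-pos : 0ℚ < tenth
  tenth-pos = *<* (ℤ.+<+ (s≤s z≤n))

  tenth<1 : tenth < 1ℚ
  tenth<1 = *<* (ℤ.+<+ (s≤s (s≤s z≤n)))

  *-monoˡ-≤-0≤ : ∀ {r x y} → 0ℚ ≤ r → x ≤ y → r * x ≤ r * y
  *-monoˡ-≤-0≤ {r} 0≤r = *-monoˡ-≤-nonNeg r {{nonNegative 0≤r}}

  *-monoʳ-≤-0≤ : ∀ {r x y} → 0ℚ ≤ r → x ≤ y → x * r ≤ y * r
  *-monoʳ-≤-0≤ {r} 0≤r = *-monoʳ-≤-nonNeg r {{nonNegative 0≤r}}

  *-0≤ : ∀ {x y} → 0ℚ ≤ x → 0ℚ ≤ y → 0ℚ ≤ x * y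
  *-0≤ {x} 0≤x 0≤y = ≤-trans (≤-reflexive (sym (*-zeroʳ x))) (*-monoˡ-≤-0≤ 0≤x 0≤y)

  *-0< : ∀ {x y} → 0ℚ < x → 0ℚ < y → 0ℚ < x * y
  *-0< {x} 0<x 0<y = ≤-<-trans (≤-reflexive (sym (*-zeroʳ x))) (*-monoʳ-<-pos x {{positive 0<x}} 0<y)

  p≤q⇒0≤q-p : ∀ {p q} → p ≤ q → 0ℚ ≤ q - p
  p≤q⇒0≤q-p {p} p≤q = ≤-trans (≤-reflexive (sym (+-inverseʳ p))) (+-monoˡ-≤ (- p) p≤q)

  ≤-*-≥1 : ∀ {c x} → 1ℚ ≤ c → 0ℚ ≤ x → x ≤ c * x
  ≤-*-≥1 {c} {x} 1≤c 0≤x = ≤-trans (≤-reflexive (sym (*-identityˡ x))) (*-monoʳ-≤-0≤ 0≤x 1≤c)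

  ≤-by-difference : ∀ {p q} e → 0ℚ ≤ e → q - p ≡ e → p ≤ q
  ≤-by-difference {p} {q} e 0≤e q-p≡e = begin
    p            ≡⟨ +-identityˡ p ⟨
    0ℚ + p       ≤⟨ +-monoˡ-≤ p 0≤e ⟩
    e + p        ≡⟨ cong (_+ p) q-p≡e ⟨
    (q - p) + p  ≡⟨ solve 2 (λ q p → (q :- p) :+ p := q) refl q p ⟩
    q            ∎
    where open ≤-Reasoning

  ⊓-+-≤ : ∀ x y q → 0ℚ ≤ x → (x + y) ⊓ q ≤ x + (y ⊓ q)
  ⊓-+-≤ x y q 0≤x with ≤-total y q
  ... | inj₁ y≤q rewrite p≤q⇒p⊓q≡p y≤q = p⊓q≤p (x + y) q
  ... | inj₂ q≤y rewrite p≥q⇒p⊓q≡q q≤y =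
    ≤-trans (p⊓q≤q (x + y) q) (≤-trans (≤-reflexive (sym (+-identityˡ q))) (+-monoˡ-≤ q 0≤x))

  pos⇒≢0 : ∀ {q} → 0ℚ < q → q ≢ 0ℚ
  pos⇒≢0 0<q q≡0 = <-irrefl (sym q≡0) 0<q

  inv-inverseʳ : ∀ q → q ≢ 0ℚ → q * inv q ≡ 1ℚ
  inv-inverseʳ q q≢0 with q ≟ 0ℚ
  ... | yes q≡0 = ⊥-elim (q≢0 q≡0)
  ... | no q≢0′ = *-inverseʳ q {{≢-nonZero q≢0′}}

  inv-inverseˡ : ∀ q → q ≢ 0ℚ → inv q * q ≡ 1ℚ
  inv-inverseˡ q q≢0 = trans (*-comm (inv q) q) (inv-inverseʳ q q≢0)

  inv-pos : ∀ {q} → 0ℚ < q → 0ℚ < inv q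
  inv-pos {q} 0<q with q ≟ 0ℚ
  ... | yes q≡0 = ⊥-elim (pos⇒≢0 0<q q≡0)
  ... | no q≢0 = positive⁻¹ _ {{1/pos⇒pos q {{positive 0<q}}}}

  inv-antimono-≤ : ∀ {p q} → 0ℚ < p → p ≤ q → inv q ≤ inv p
  inv-antimono-≤ {p} {q} 0<p p≤q = begin
    inv q                ≡⟨ *-identityʳ (inv q) ⟨
    inv q * 1ℚ           ≡⟨ cong (inv q *_) (inv-inverseʳ p (pos⇒≢0 0<p)) ⟨
    inv q * (p * inv p)  ≤⟨ *-monoˡ-≤-0≤ (<⇒≤ (inv-pos 0<q)) (*-monoʳ-≤-0≤ (<⇒≤ (inv-pos 0<p)) p≤q) ⟩
    inv q * (q * inv p)  ≡⟨ *-assoc (inv q) q (inv p) ⟨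
    (inv q * q) * inv p  ≡⟨ cong (_* inv p) (inv-inverseˡ q (pos⇒≢0 0<q)) ⟩
    1ℚ * inv p           ≡⟨ *-identityˡ (inv p) ⟩
    inv p                ∎
    where
      open ≤-Reasoning
      0<q = <-≤-trans 0<p p≤q

  sum : (Fin N → ℚ) → ℚ
  sum {zero}  f = 0ℚ
  sum {suc N} f = f zero + sum (λ i → f (suc i))

  sum-cong : {f g : Fin N → ℚ} → (∀ i → f i ≡ g i) → sum f ≡ sum g
  sum-cong {zero}  f≡g = refl
  sum-cong {suc N} f≡g = cong₂ _+_ (f≡g zero) (sum-cong (λ i → f≡g (suc i)))

  sum-distrib-+ : (f g : Fin N → ℚ) → sum (λ i → f i + g i) ≡ sum f + sum g
  sum-distrib-+ {zero}  f g = refl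
  sum-distrib-+ {suc N} f g = begin
    (f zero + g zero) + sum (λ i → f (suc i) + g (suc i))            ≡⟨ cong ((f zero + g zero) +_) (sum-distrib-+ (λ i → f (suc i)) (λ i → g (suc i))) ⟩
    (f zero + g zero) + (sum (λ i → f (suc i)) + sum (λ i → g (suc i))) ≡⟨ solve 4 (λ a b c d → (a :+ b) :+ (c :+ d) := (a :+ c) :+ (b :+ d)) refl (f zero) (g zero) _ _ ⟩
    (f zero + sum (λ i → f (suc i))) + (g zero + sum (λ i → g (suc i))) ∎
    where open ≡-Reasoning

  *-distribˡ-sum : (c : ℚ) (f : Fin N → ℚ) → c * sum f ≡ sum (λ i → c * f i)
  *-distribˡ-sum {zero}  c f = *-zeroʳ c
  *-distribˡ-sum {suc N} c f = trans (*-distribˡ-+ c (f zero) _) (cong (c * f zero +_) (*-distribˡ-sum c (λ i → f (suc i))))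

  *-distribʳ-sum : (c : ℚ) (f : Fin N → ℚ) → sum f * c ≡ sum (λ i → f i * c)
  *-distribʳ-sum {zero}  c f = *-zeroˡ c
  *-distribʳ-sum {suc N} c f = trans (*-distribʳ-+ c (f zero) _) (cong (f zero * c +_) (*-distribʳ-sum c (λ i → f (suc i))))

  sum-zero : {f : Fin N → ℚ} → (∀ i → f i ≡ 0ℚ) → sum f ≡ 0ℚ
  sum-zero {zero}  f≡0 = refl
  sum-zero {suc N} f≡0 = trans (cong₂ _+_ (f≡0 zero) (sum-zero (λ i → f≡0 (suc i)))) (+-identityˡ 0ℚ)

  sum-comm : (f : Fin M → Fin N → ℚ) → sum (λ i → sum (λ j → f i j)) ≡ sum (λ j → sum (λ i → f i j))
  sum-comm {zero} {N} f = sym (sum-zero {N} (λ j → refl))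
  sum-comm {suc M} f = trans (cong (sum (λ j → f zero j) +_) (sum-comm (λ i → f (suc i))))
                           (sym (sum-distrib-+ (λ j → f zero j) (λ j → sum (λ i → f (suc i) j))))

  sum-mono-≤ : {f g : Fin N → ℚ} → (∀ i → f i ≤ g i) → sum f ≤ sum g
  sum-mono-≤ {zero}  f≤g = ≤-refl
  sum-mono-≤ {suc N} f≤g = +-mono-≤ (f≤g zero) (sum-mono-≤ (λ i → f≤g (suc i)))

  sum-nonNeg : {f : Fin N → ℚ} → (∀ i → 0ℚ ≤ f i) → 0ℚ ≤ sum f
  sum-nonNeg {N} 0≤f = ≤-trans (≤-reflexive (sym (sum-zero {N} (λ _ → refl)))) (sum-mono-≤ 0≤f)

  sum-neg : (f : Fin N → ℚ) → sum (λ i → - f i) ≡ - sum f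
  sum-neg {zero}  f = refl
  sum-neg {suc N} f = trans (cong ((- f zero) +_) (sum-neg (λ i → f (suc i)))) (sym (neg-distrib-+ (f zero) _))

  sum-sub : (f g : Fin N → ℚ) → sum (λ i → f i - g i) ≡ sum f - sum g
  sum-sub f g = trans (sum-distrib-+ f (λ i → - g i)) (cong (sum f +_) (sum-neg g))

  sum-single : {f : Fin N → ℚ} (t : Fin N) → (∀ i → i ≢ t → f i ≡ 0ℚ) → sum f ≡ f t
  sum-single {suc N} {f} zero    f≡0 =
    trans (cong (f zero +_) (sum-zero (λ i → f≡0 (suc i) (λ ())))) (+-identityʳ (f zero))
  sum-single {suc N} {f} (suc t) f≡0 =
    trans (cong₂ _+_ (f≡0 zero (λ ())) (sum-single t (λ i i≢t → f≡0 (suc i) (λ e → i≢t (Finₚ.suc-injective e)))))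
          (+-identityˡ (f (suc t)))

  sumℕ : (Fin N → ℕ) → ℕ
  sumℕ {zero}  c = 0
  sumℕ {suc N} c = c zero ℕ.+ sumℕ (λ i → c (suc i))

  ℕ→ℚ-sum : (c : Fin N → ℕ) → ℕ→ℚ (sumℕ c) ≡ sum (λ i → ℕ→ℚ (c i))
  ℕ→ℚ-sum {zero}  c = refl
  ℕ→ℚ-sum {suc N} c = trans (ℕ→ℚ-+ (c zero) _) (cong (ℕ→ℚ (c zero) +_) (ℕ→ℚ-sum (λ i → c (suc i))))

  𝟙 : Bool → ℚ
  𝟙 b = if b then 1ℚ else 0ℚ

  count : (Fin N → Bool) → ℕ
  count {zero}  P = 0
  count {suc N} P = (if P zero then 1 else 0) ℕ.+ count (λ i → P (suc i))

  _⊆ᵇ_ : (Fin N → Bool) → (Fin N → Bool) → Set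
  P ⊆ᵇ Q = ∀ i → P i ≡ true → Q i ≡ true

  𝟙-nonNeg : ∀ b → 0ℚ ≤ 𝟙 b
  𝟙-nonNeg true  = <⇒≤ 0<1
  𝟙-nonNeg false = ≤-refl

  if-0≡*𝟙 : ∀ b (x : ℚ) → (if b then x else 0ℚ) ≡ x * 𝟙 b
  if-0≡*𝟙 true  x = sym (*-identityʳ x)
  if-0≡*𝟙 false x = sym (*-zeroʳ x)

  𝟙-mono-≤ : ∀ {b b′} → (b ≡ true → b′ ≡ true) → 𝟙 b ≤ 𝟙 b′
  𝟙-mono-≤ {false} {b′} _ = 𝟙-nonNeg b′
  𝟙-mono-≤ {true}       b⇒b′ rewrite b⇒b′ refl = ≤-refl

  if-*ˡ : ∀ b (w x : ℚ) → (if b then w else 0ℚ) * x ≡ w * (if b then x else 0ℚ)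
  if-*ˡ true  w x = refl
  if-*ˡ false w x = trans (*-zeroˡ x) (sym (*-zeroʳ w))

  if-mono-≤ : ∀ b {x y : ℚ} → x ≤ y → (if b then x else 0ℚ) ≤ (if b then y else 0ℚ)
  if-mono-≤ true  x≤y = x≤y
  if-mono-≤ false _   = ≤-refl

  sum-𝟙 : (P : Fin N → Bool) → sum (λ i → 𝟙 (P i)) ≡ ℕ→ℚ (count P)
  sum-𝟙 {zero}  P = refl
  sum-𝟙 {suc N} P with P zero
  ... | true  = trans (cong (1ℚ +_) (sum-𝟙 (λ i → P (suc i)))) (sym (ℕ→ℚ-+ 1 (count (λ i → P (suc i)))))
  ... | false = trans (+-identityˡ _) (sum-𝟙 (λ i → P (suc i)))

  sum-if : (P : Fin N → Bool) (c : ℚ) → sum (λ i → if P i then c else 0ℚ) ≡ c * ℕ→ℚ (count P)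
  sum-if P c = begin
    sum (λ i → if P i then c else 0ℚ)  ≡⟨ sum-cong (λ i → if-0≡*𝟙 (P i) c) ⟩
    sum (λ i → c * 𝟙 (P i))            ≡⟨ *-distribˡ-sum c (λ i → 𝟙 (P i)) ⟨
    c * sum (λ i → 𝟙 (P i))            ≡⟨ cong (c *_) (sum-𝟙 P) ⟩
    c * ℕ→ℚ (count P)                  ∎
    where open ≡-Reasoning

  sum-𝟙-≤1 : (P : Fin N → Bool) → (∀ i i′ → P i ≡ true → P i′ ≡ true → i ≡ i′) → sum (λ i → 𝟙 (P i)) ≤ 1ℚ
  sum-𝟙-≤1 {zero}  P unique = <⇒≤ 0<1
  sum-𝟙-≤1 {suc N} P unique with P zero in P0
  ... | true  = ≤-reflexive (trans (cong (1ℚ +_) (sum-zero rest-false)) (+-identityʳ 1ℚ))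
    where
      rest-false : ∀ i → 𝟙 (P (suc i)) ≡ 0ℚ
      rest-false i with P (suc i) in Pi
      ... | true with () ← unique zero (suc i) P0 Pi
      ... | false = refl
  ... | false = ≤-trans (≤-reflexive (+-identityˡ _)) (sum-𝟙-≤1 (λ i → P (suc i)) (λ i i′ e e′ → Finₚ.suc-injective (unique (suc i) (suc i′) e e′)))

  sum-if-∧ : (P Q : Fin M → Bool) (f g : Fin M → ℚ) →
    sum (λ o → sum (λ b → if P o ∧ Q b then f o * g b else 0ℚ)) ≡ sum (λ o → if P o then f o else 0ℚ) * sum (λ b → if Q b then g b else 0ℚ)
  sum-if-∧ P Q f g = begin
    sum (λ o → sum (λ b → if P o ∧ Q b then f o * g b else 0ℚ))  ≡⟨ sum-cong (λ o → sum-cong (λ b → split (P o) (Q b) (f o) (g b))) ⟩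
    sum (λ o → sum (λ b → x o * y b))                            ≡⟨ sum-cong (λ o → *-distribˡ-sum (x o) y) ⟨
    sum (λ o → x o * sum y)                                      ≡⟨ *-distribʳ-sum (sum y) x ⟨
    sum x * sum y                                                ∎
    where
      open ≡-Reasoning
      x = λ o → if P o then f o else 0ℚ
      y = λ b → if Q b then g b else 0ℚ
      split : ∀ p q u v → (if p ∧ q then u * v else 0ℚ) ≡ (if p then u else 0ℚ) * (if q then v else 0ℚ)
      split true  true  u v = refl
      split true  false u v = sym (*-zeroʳ u)
      split false q     u v = sym (*-zeroˡ (if q then v else 0ℚ))

  count-mono : {P Q : Fin N → Bool} → P ⊆ᵇ Q → count P ℕ.≤ count Q
  count-mono {zero}          P⊆Q = z≤n
  count-mono {suc N} {P} {Q} P⊆Q with P zero in P0 | Q zero in Q0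
  ... | true  | true  = s≤s (count-mono (λ i → P⊆Q (suc i)))
  ... | true  | false with () ← trans (sym Q0) (P⊆Q zero P0)
  ... | false | true  = ℕₚ.m≤n⇒m≤1+n (count-mono (λ i → P⊆Q (suc i)))
  ... | false | false = count-mono (λ i → P⊆Q (suc i))

  count-cong : {P Q : Fin N → Bool} → (∀ i → P i ≡ Q i) → count P ≡ count Q
  count-cong P≡Q = ℕₚ.≤-antisym (count-mono (λ i e → trans (sym (P≡Q i)) e)) (count-mono (λ i e → trans (P≡Q i) e))

  count-false : count {N} (λ _ → false) ≡ 0
  count-false {zero}  = refl
  count-false {suc N} = count-false {N}

  count-pos : {P : Fin N → Bool} (i : Fin N) → P i ≡ true → 1 ℕ.≤ count P
  count-pos {suc N} {P} zero    Pi rewrite Pi = s≤s z≤n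
  count-pos {suc N} {P} (suc i) Pi = ℕₚ.≤-trans (count-pos {P = λ j → P (suc j)} i Pi) (ℕₚ.m≤n+m _ _)

  count-pos⇒∃ : {P : Fin N → Bool} → 1 ℕ.≤ count P → Σ[ i ∈ Fin N ] P i ≡ true
  count-pos⇒∃ {suc N} {P} 1≤∣P∣ with P zero in P0
  ... | true  = zero , P0
  ... | false with (i , Pi) ← count-pos⇒∃ {P = λ j → P (suc j)} 1≤∣P∣ = suc i , Pi

  ∣p∣≡count : (p : Subset N) → ∣ p ∣ ≡ count (lookup p)
  ∣p∣≡count []          = refl
  ∣p∣≡count (true ∷ p)  = cong suc (∣p∣≡count p)
  ∣p∣≡count (false ∷ p) = ∣p∣≡count p

  ∣tabulate∣≡count : (P : Fin N → Bool) → ∣ tabulate P ∣ ≡ count P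
  ∣tabulate∣≡count P = trans (∣p∣≡count (tabulate P)) (count-cong (Vecₚ.lookup∘tabulate P))

  lookup-∪ : (p q : Subset N) (i : Fin N) → lookup (p ∪ q) i ≡ lookup p i ∨ lookup q i
  lookup-∪ p q i = Vecₚ.lookup-zipWith _∨_ i p q

  lookup-─ : (p q : Subset N) (i : Fin N) → lookup (p ─ q) i ≡ lookup p i ∧ not (lookup q i)
  lookup-─ (x ∷ p) (true  ∷ q) zero    = sym (Boolₚ.∧-zeroʳ x)
  lookup-─ (x ∷ p) (false ∷ q) zero    = sym (Boolₚ.∧-identityʳ x)
  lookup-─ (x ∷ p) (_     ∷ q) (suc i) = lookup-─ p q i

  ∈⇒lookup : {p : Subset N} {i : Fin N} → i ∈ p → lookup p i ≡ true
  ∈⇒lookup = Vecₚ.[]=⇒lookup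

  lookup⇒∈ : {p : Subset N} {i : Fin N} → lookup p i ≡ true → i ∈ p
  lookup⇒∈ {p = p} {i} = Vecₚ.lookup⇒[]= i p

  lookup-∩ : (p q : Subset N) (i : Fin N) → lookup (p ∩ q) i ≡ lookup p i ∧ lookup q i
  lookup-∩ p q i = Vecₚ.lookup-zipWith _∧_ i p q

  nonempty : (p : Subset N) → 1 ℕ.≤ ∣ p ∣ → Σ[ i ∈ Fin N ] lookup p i ≡ true
  nonempty p 1≤∣p∣ = count-pos⇒∃ (ℕₚ.≤-trans 1≤∣p∣ (ℕₚ.≤-reflexive (∣p∣≡count p)))

  _∨ᵇ_ : (Fin N → Bool) → (Fin N → Bool) → Fin N → Bool
  (P ∨ᵇ Q) i = P i ∨ Q i

  _─ᵇ_ : (Fin N → Bool) → (Fin N → Bool) → Fin N → Bool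
  (P ─ᵇ Q) i = P i ∧ not (Q i)

  count-─ : (G B : Fin N → Bool) → B ⊆ᵇ G → count (G ─ᵇ B) ℕ.+ count B ≡ count G
  count-─ {zero}  G B B⊆G = refl
  count-─ {suc N} G B B⊆G with G zero in G0 | B zero in B0
  ... | true  | true  = trans (ℕₚ.+-suc _ _) (cong suc (count-─ (λ i → G (suc i)) (λ i → B (suc i)) (λ i → B⊆G (suc i))))
  ... | true  | false = cong suc (count-─ (λ i → G (suc i)) (λ i → B (suc i)) (λ i → B⊆G (suc i)))
  ... | false | true  with () ← trans (sym G0) (B⊆G zero B0)
  ... | false | false = count-─ (λ i → G (suc i)) (λ i → B (suc i)) (λ i → B⊆G (suc i))

  ∣[p∪q]─r∣≡∣p∣ : (p q r : Subset N) → r ⊆ p → q ⊆ ∁ p → ∣ r ∣ ≡ ∣ q ∣ → ∣ (p ∪ q) ─ r ∣ ≡ ∣ p ∣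
  ∣[p∪q]─r∣≡∣p∣ p q r r⊆p q⊆∁p ∣r∣≡∣q∣ = ℕₚ.+-cancelʳ-≡ (count R) _ _ (begin
    ∣ (p ∪ q) ─ r ∣ ℕ.+ count R                  ≡⟨ cong (ℕ._+ count R) (trans (∣p∣≡count ((p ∪ q) ─ r)) (count-cong lookup-result)) ⟩
    count ((P ∨ᵇ Q) ─ᵇ R) ℕ.+ count R            ≡⟨ count-─ (P ∨ᵇ Q) R (λ i e → trans (cong (_∨ Q i) (r⊆p′ i e)) refl) ⟩
    count (P ∨ᵇ Q)                               ≡⟨ count-─ (P ∨ᵇ Q) Q (λ i e → trans (cong (P i ∨_) e) (Boolₚ.∨-zeroʳ (P i))) ⟨
    count ((P ∨ᵇ Q) ─ᵇ Q) ℕ.+ count Q            ≡⟨ cong₂ ℕ._+_ (count-cong drop-q) (trans (sym (∣p∣≡count q)) (sym ∣r∣≡∣q∣)) ⟩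
    count P ℕ.+ ∣ r ∣                            ≡⟨ cong₂ ℕ._+_ (sym (∣p∣≡count p)) (∣p∣≡count r) ⟩
    ∣ p ∣ ℕ.+ count R                            ∎)
    where
      open ≡-Reasoning
      P = lookup p
      Q = lookup q
      R = lookup r
      r⊆p′ : R ⊆ᵇ P
      r⊆p′ i e = ∈⇒lookup (r⊆p (lookup⇒∈ e))
      q∉p : ∀ i → Q i ≡ true → P i ≡ false
      q∉p i e = Boolₚ.not-injective (trans (sym (Vecₚ.lookup-map i not p)) (∈⇒lookup (q⊆∁p (lookup⇒∈ e))))
      lookup-result : ∀ i → lookup ((p ∪ q) ─ r) i ≡ ((P ∨ᵇ Q) ─ᵇ R) i
      lookup-result i = trans (lookup-─ (p ∪ q) r i) (cong (λ x → x ∧ not (R i)) (lookup-∪ p q i))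
      drop-q : ∀ i → ((P ∨ᵇ Q) ─ᵇ Q) i ≡ P i
      drop-q i with Q i in Qi
      ... | true  rewrite q∉p i Qi = refl
      ... | false = trans (Boolₚ.∧-identityʳ _) (Boolₚ.∨-identityʳ (P i))

  _==_ : Fin N → Fin N → Bool
  x == y = ⌊ x Finₚ.≟ y ⌋

  ==-refl : (x : Fin N) → (x == x) ≡ true
  ==-refl x with x Finₚ.≟ x
  ... | yes _   = refl
  ... | no x≢x = ⊥-elim (x≢x refl)

  ==⇒≡ : {x y : Fin N} → (x == y) ≡ true → x ≡ y
  ==⇒≡ {x = x} {y} e with x Finₚ.≟ y
  ... | yes x≡y = x≡y

  ≢⇒==-false : {x y : Fin N} → x ≢ y → (x == y) ≡ false
  ≢⇒==-false {x = x} {y} x≢y with x Finₚ.≟ y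
  ... | yes x≡y = ⊥-elim (x≢y x≡y)
  ... | no _    = refl

  ⁅_⁆ᵇ : Fin N → Fin N → Bool
  ⁅ x ⁆ᵇ y = y == x

  count-⁅⁆ : (x : Fin N) → count ⁅ x ⁆ᵇ ≡ 1
  count-⁅⁆ x = ℕ→ℚ-injective (begin
    ℕ→ℚ (count ⁅ x ⁆ᵇ)       ≡⟨ sum-𝟙 ⁅ x ⁆ᵇ ⟨
    sum (λ y → 𝟙 (y == x))  ≡⟨ sum-single x (λ y y≢x → cong 𝟙 (≢⇒==-false y≢x)) ⟩
    𝟙 (x == x)              ≡⟨ cong 𝟙 (==-refl x) ⟩
    1ℚ                      ∎)
    where open ≡-Reasoning

  sum-𝟙-== : (x : Fin N) (P : Fin N → Bool) → sum (λ y → if P y then 𝟙 (x == y) else 0ℚ) ≡ 𝟙 (P x)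
  sum-𝟙-== x P = trans (sum-single x off-x) (trans (cong (λ e → if P x then 𝟙 e else 0ℚ) (==-refl x)) (lemma (P x)))
    where
      off-x : ∀ y → y ≢ x → (if P y then 𝟙 (x == y) else 0ℚ) ≡ 0ℚ
      off-x y y≢x rewrite ≢⇒==-false {x = x} (λ x≡y → y≢x (sym x≡y)) with P y
      ... | true  = refl
      ... | false = refl
      lemma : ∀ b → (if b then 1ℚ else 0ℚ) ≡ 𝟙 b
      lemma true  = refl
      lemma false = refl

  sum-𝟙-==-∧ : (x : Fin N) (b : Bool) → sum (λ y → 𝟙 ((y == x) ∧ b)) ≡ 𝟙 b
  sum-𝟙-==-∧ x b = trans (sum-single x (λ y y≢x → cong (λ e → 𝟙 (e ∧ b)) (≢⇒==-false y≢x))) (cong (λ e → 𝟙 (e ∧ b)) (==-refl x))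

  subset-of-size : (G : Fin N → Bool) (c : ℕ) → c ℕ.≤ count G → Σ[ B ∈ (Fin N → Bool) ] B ⊆ᵇ G × count B ≡ c
  subset-of-size {N}     G zero    _ = (λ _ → false) , (λ _ ()) , count-false {N}
  subset-of-size {suc N} G (suc c) c<∣G∣ with G zero in G0
  ... | true  with (B , B⊆G , ∣B∣) ← subset-of-size (λ i → G (suc i)) c (ℕ.s≤s⁻¹ c<∣G∣) =
    (true Vector.∷ B) , (λ { zero _ → G0 ; (suc i) → B⊆G i }) , cong suc ∣B∣
  ... | false with (B , B⊆G , ∣B∣) ← subset-of-size (λ i → G (suc i)) (suc c) c<∣G∣ =
    (false Vector.∷ B) , (λ { (suc i) → B⊆G i }) , ∣B∣

  DisjointSubsetsOfSizes : (G : Fin N → Bool) (c : Fin M → ℕ) → Set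
  DisjointSubsetsOfSizes {N} {M} G c =
    Σ[ B ∈ (Fin M → Fin N → Bool) ]
      (∀ t → B t ⊆ᵇ G) × (∀ t → count (B t) ≡ c t) × (∀ t t′ b → B t b ≡ true → B t′ b ≡ true → t ≡ t′)

  private
    cons-disjoint : {G B₀ : Fin N → Bool} {c : Fin (suc M) → ℕ} → B₀ ⊆ᵇ G → count B₀ ≡ c zero →
                    DisjointSubsetsOfSizes (G ─ᵇ B₀) (λ t → c (suc t)) → DisjointSubsetsOfSizes G c
    cons-disjoint {G = G} {B₀} B₀⊆G ∣B₀∣ (B , B⊆G─B₀ , ∣B∣ , B-disj) = (B₀ Vector.∷ B) , B′⊆G , ∣B′∣ , B′-disj
      where
        B′⊆G : ∀ t → (B₀ Vector.∷ B) t ⊆ᵇ G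
        B′⊆G zero    = B₀⊆G
        B′⊆G (suc t) b e = Boolₚ.∧-conicalˡ _ _ (B⊆G─B₀ t b e)
        ∣B′∣ : ∀ t → count ((B₀ Vector.∷ B) t) ≡ _
        ∣B′∣ zero    = ∣B₀∣
        ∣B′∣ (suc t) = ∣B∣ t
        outside-B₀ : ∀ t b → B t b ≡ true → B₀ b ≢ true
        outside-B₀ t b e e₀ with () ← trans (sym (Boolₚ.∧-conicalʳ (G b) _ (B⊆G─B₀ t b e))) (cong not e₀)
        B′-disj : ∀ t t′ b → (B₀ Vector.∷ B) t b ≡ true → (B₀ Vector.∷ B) t′ b ≡ true → t ≡ t′
        B′-disj zero    zero     b _  _  = refl
        B′-disj zero    (suc t′) b e₀ e  = ⊥-elim (outside-B₀ t′ b e e₀)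
        B′-disj (suc t) zero     b e  e₀ = ⊥-elim (outside-B₀ t b e e₀)
        B′-disj (suc t) (suc t′) b e  e′ = cong suc (B-disj t t′ b e e′)

    rest-fits : {G B₀ : Fin N → Bool} (c : Fin (suc M) → ℕ) → B₀ ⊆ᵇ G → count B₀ ≡ c zero →
                sumℕ c ℕ.≤ count G → sumℕ (λ t → c (suc t)) ℕ.≤ count (G ─ᵇ B₀)
    rest-fits {G = G} {B₀} c B₀⊆G ∣B₀∣ Σc≤∣G∣ = ℕₚ.+-cancelʳ-≤ (c zero) _ _ (begin
      sumℕ (λ t → c (suc t)) ℕ.+ c zero  ≡⟨ ℕₚ.+-comm _ (c zero) ⟩
      sumℕ c                            ≤⟨ Σc≤∣G∣ ⟩
      count G                             ≡⟨ count-─ G B₀ B₀⊆G ⟨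
      count (G ─ᵇ B₀) ℕ.+ count B₀        ≡⟨ cong (count (G ─ᵇ B₀) ℕ.+_) ∣B₀∣ ⟩
      count (G ─ᵇ B₀) ℕ.+ c zero          ∎)
      where open ℕₚ.≤-Reasoning

  disjoint-subsets-of-sizes : (G : Fin N → Bool) (c : Fin M → ℕ) → sumℕ c ℕ.≤ count G → DisjointSubsetsOfSizes G c
  disjoint-subsets-of-sizes {M = zero}  G c _ = (λ ()) , (λ ()) , (λ ()) , (λ ())
  disjoint-subsets-of-sizes {M = suc M} G c Σc≤∣G∣
    with B₀ , B₀⊆G , ∣B₀∣ ← subset-of-size G (c zero) (ℕₚ.≤-trans (ℕₚ.m≤m+n (c zero) _) Σc≤∣G∣) =
    cons-disjoint B₀⊆G ∣B₀∣ (disjoint-subsets-of-sizes (G ─ᵇ B₀) (λ t → c (suc t)) (rest-fits c B₀⊆G ∣B₀∣ Σc≤∣G∣))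

  minimiser : (X : Fin N → Bool) (f : Fin N → ℕ) → Σ[ i ∈ Fin N ] X i ≡ true →
              Σ[ i ∈ Fin N ] X i ≡ true × (∀ i′ → X i′ ≡ true → f i ℕ.≤ f i′)
  minimiser {N} X f (i₀ , Xi₀) =
    argmin f i₀ xs ,
    argmin-all f Xi₀ (all-filter X? (List.allFin N)) ,
    λ i′ Xi′ → All.lookup (f[argmin]≤f[xs] {f = f} i₀ xs) (∈-filter⁺ X? (∈-allFin i′) Xi′)
    where
      X? : Decidable (λ i → X i ≡ true)
      X? i = X i Boolₚ.≟ true
      xs = List.filter X? (List.allFin N)

  foldr-tabulate : (c : A → B → B) (e : B) (h : Fin N → A) → List.foldr c e (List.tabulate h) ≡ Vector.foldr c e h
  foldr-tabulate {N = zero}  c e h = refl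
  foldr-tabulate {N = suc N} c e h = cong (c (h zero)) (foldr-tabulate c e (λ i → h (suc i)))

  foldr-+≡sum : (f : A → ℚ) (h : Fin N → A) → Vector.foldr (λ a acc → f a + acc) 0ℚ h ≡ sum (λ i → f (h i))
  foldr-+≡sum {N = zero}  f h = refl
  foldr-+≡sum {N = suc N} f h = cong (f (h zero) +_) (foldr-+≡sum f (λ i → h (suc i)))

  foldr-+≡count : (P : A → Bool) (h : Fin N → A) →
                  Vector.foldr (λ a acc → (if P a then 1 else 0) ℕ.+ acc) 0 h ≡ count (λ i → P (h i))
  foldr-+≡count {N = zero}  P h = refl
  foldr-+≡count {N = suc N} P h = cong ((if P (h zero) then 1 else 0) ℕ.+_) (foldr-+≡count P (λ i → h (suc i)))

  module _ (X : A → Bool) (g : A → ℚ) where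

    private
      min-step : A → ℚ → ℚ
      min-step a acc = if X a then g a ⊓ acc else acc

    foldr-⊓≤init : ∀ e (h : Fin N → A) → Vector.foldr min-step e h ≤ e
    foldr-⊓≤init {zero}  e h = ≤-refl
    foldr-⊓≤init {suc N} e h with X (h zero)
    ... | true  = ≤-trans (p⊓q≤q (g (h zero)) _) (foldr-⊓≤init e (λ i → h (suc i)))
    ... | false = foldr-⊓≤init e (λ i → h (suc i))

    foldr-⊓≤ : ∀ e (h : Fin N → A) (i : Fin N) → X (h i) ≡ true → Vector.foldr min-step e h ≤ g (h i)
    foldr-⊓≤ e h zero    Xhi rewrite Xhi = p⊓q≤p _ _
    foldr-⊓≤ e h (suc i) Xhi with X (h zero)
    ... | true  = ≤-trans (p⊓q≤q (g (h zero)) _) (foldr-⊓≤ e (λ i → h (suc i)) i Xhi)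
    ... | false = foldr-⊓≤ e (λ i → h (suc i)) i Xhi

    foldr-⊓-glb : ∀ {L} e (h : Fin N → A) → L ≤ e → (∀ i → X (h i) ≡ true → L ≤ g (h i)) →
                  L ≤ Vector.foldr min-step e h
    foldr-⊓-glb {zero}  e h L≤e L≤g = L≤e
    foldr-⊓-glb {suc N} e h L≤e L≤g with X (h zero) in X0
    ... | true  = ⊓-glb (L≤g zero X0) (foldr-⊓-glb e (λ i → h (suc i)) L≤e (λ i → L≤g (suc i)))
    ... | false = foldr-⊓-glb e (λ i → h (suc i)) L≤e (λ i → L≤g (suc i))

  module _ (X : A → Bool) (g : A → ℕ) where

    foldr-⊓ℕ-glb : ∀ {L} e (h : Fin N → A) → L ℕ.≤ e → (∀ i → X (h i) ≡ true → L ℕ.≤ g (h i)) →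
                   L ℕ.≤ Vector.foldr (λ a acc → if X a then g a ℕ.⊓ acc else acc) e h
    foldr-⊓ℕ-glb {zero}  e h L≤e L≤g = L≤e
    foldr-⊓ℕ-glb {suc N} e h L≤e L≤g with X (h zero) in X0
    ... | true  = ℕₚ.⊓-glb (L≤g zero X0) (foldr-⊓ℕ-glb e (λ i → h (suc i)) L≤e (λ i → L≤g (suc i)))
    ... | false = foldr-⊓ℕ-glb e (λ i → h (suc i)) L≤e (λ i → L≤g (suc i))

  foldr-⊔-ub : (g : A → ℕ) (h : Fin N → A) (i : Fin N) → g (h i) ℕ.≤ Vector.foldr (λ a acc → g a ℕ.⊔ acc) 0 h
  foldr-⊔-ub g h zero    = ℕₚ.m≤m⊔n _ _
  foldr-⊔-ub g h (suc i) = ℕₚ.≤-trans (foldr-⊔-ub g (λ i → h (suc i)) i) (ℕₚ.m≤n⊔m _ _)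

  SwapFn : ℕ → Set
  SwapFn m = (Fin m → Bool) → (Fin m → Bool) → ℚ

  module _ {m : ℕ} where

    private
      sum₃ : (Fin m → Fin m → Fin m → ℚ) → ℚ
      sum₃ f = sum (λ i → sum (λ j → sum (λ k → f i j k)))

      sum₃-cong : {f g : Fin m → Fin m → Fin m → ℚ} → (∀ i j k → f i j k ≡ g i j k) → sum₃ f ≡ sum₃ g
      sum₃-cong f≡g = sum-cong (λ i → sum-cong (λ j → sum-cong (f≡g i j)))

      sum₃-mono-≤ : {f g : Fin m → Fin m → Fin m → ℚ} → (∀ i j k → f i j k ≤ g i j k) → sum₃ f ≤ sum₃ g
      sum₃-mono-≤ f≤g = sum-mono-≤ (λ i → sum-mono-≤ (λ j → sum-mono-≤ (f≤g i j)))

      sum₃-+ : (f g : Fin m → Fin m → Fin m → ℚ) → sum₃ (λ i j k → f i j k + g i j k) ≡ sum₃ f + sum₃ g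
      sum₃-+ f g = trans (sum-cong (λ i → trans (sum-cong (λ j → sum-distrib-+ (f i j) (g i j)))
                                                   (sum-distrib-+ (λ j → sum (f i j)) (λ j → sum (g i j)))))
                         (sum-distrib-+ (λ i → sum (λ j → sum (f i j))) (λ i → sum (λ j → sum (g i j))))

      sum₃-*ˡ : (c : ℚ) (f : Fin m → Fin m → Fin m → ℚ) → sum₃ (λ i j k → c * f i j k) ≡ c * sum₃ f
      sum₃-*ˡ c f = sym (trans (*-distribˡ-sum c (λ i → sum (λ j → sum (f i j))))
                               (sum-cong (λ i → trans (*-distribˡ-sum c (λ j → sum (f i j)))
                                                        (sum-cong (λ j → *-distribˡ-sum c (f i j))))))

      sum₃-sum : ∀ {n} (f : Fin n → Fin m → Fin m → Fin m → ℚ) →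
                 sum₃ (λ i j k → sum (λ l → f l i j k)) ≡ sum (λ l → sum₃ (f l))
      sum₃-sum f = trans (sum-cong (λ i → trans (sum-cong (λ j → sum-comm (λ k l → f l i j k)))
                                                  (sum-comm (λ j l → sum (f l i j)))))
                         (sum-comm (λ i l → sum (λ j → sum (f l i j))))

    record WeightedSwaps : Set where
      field
        weight  : Fin m → Fin m → Fin m → ℚ
        swapIn  : Fin m → Fin m → Fin m → Fin m → Bool
        swapOut : Fin m → Fin m → Fin m → Fin m → Bool

      term : SwapFn m → Fin m → Fin m → Fin m → ℚ
      term Φ i j k = weight i j k * Φ (swapIn i j k) (swapOut i j k)

      weightedSum : SwapFn m → ℚ
      weightedSum Φ = sum₃ (term Φ)

      weightedSum-cong : {Φ Ψ : SwapFn m} → (∀ A* A → Φ A* A ≡ Ψ A* A) → weightedSum Φ ≡ weightedSum Ψ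
      weightedSum-cong Φ≡Ψ = sum₃-cong (λ i j k → cong (weight i j k *_) (Φ≡Ψ _ _))

      weightedSum-+ : (Φ Ψ : SwapFn m) → weightedSum (λ A* A → Φ A* A + Ψ A* A) ≡ weightedSum Φ + weightedSum Ψ
      weightedSum-+ Φ Ψ = trans (sum₃-cong (λ i j k → *-distribˡ-+ (weight i j k) (Φ (swapIn i j k) (swapOut i j k)) (Ψ (swapIn i j k) (swapOut i j k))))
                                (sum₃-+ (term Φ) (term Ψ))

      weightedSum-*ˡ : (c : ℚ) (Φ : SwapFn m) → weightedSum (λ A* A → c * Φ A* A) ≡ c * weightedSum Φ
      weightedSum-*ˡ c Φ = trans (sum₃-cong (λ i j k → swap-factors (weight i j k) (Φ (swapIn i j k) (swapOut i j k)))) (sum₃-*ˡ c (term Φ))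
        where
          swap-factors : ∀ w x → w * (c * x) ≡ c * (w * x)
          swap-factors w x = solve 3 (λ w c x → w :* (c :* x) := c :* (w :* x)) refl w c x

      weightedSum-sum : ∀ {n} (Φ : Fin n → SwapFn m) → weightedSum (λ A* A → sum (λ l → Φ l A* A)) ≡ sum (λ l → weightedSum (Φ l))
      weightedSum-sum Φ = trans (sum₃-cong (λ i j k → *-distribˡ-sum (weight i j k) (λ l → Φ l (swapIn i j k) (swapOut i j k))))
                                (sum₃-sum (λ l → term (Φ l)))

      weightedSum-0 : weightedSum (λ _ _ → 0ℚ) ≡ 0ℚ
      weightedSum-0 = trans (sum₃-cong (λ i j k → *-zeroʳ (weight i j k)))
                            (sum-zero {m} (λ i → sum-zero {m} (λ j → sum-zero {m} (λ k → refl))))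

      weightedSum-if : (b : Bool) (Φ : SwapFn m) → weightedSum (λ A* A → if b then Φ A* A else 0ℚ) ≡ (if b then weightedSum Φ else 0ℚ)
      weightedSum-if true  Φ = refl
      weightedSum-if false Φ = weightedSum-0

      SupportedOn : ((Fin m → Bool) → (Fin m → Bool) → Set) → Set
      SupportedOn Good = ∀ i j k → 0ℚ ≤ weight i j k × (weight i j k ≡ 0ℚ ⊎ Good (swapIn i j k) (swapOut i j k))

      weightedSum-mono-≤ : ∀ {Good} → SupportedOn Good → {Φ Ψ : SwapFn m} →
                           (∀ A* A → Good A* A → Φ A* A ≤ Ψ A* A) → weightedSum Φ ≤ weightedSum Ψ
      weightedSum-mono-≤ supported {Φ} {Ψ} Φ≤Ψ = sum₃-mono-≤ term-≤
        where
          term-≤ : ∀ i j k → weight i j k * Φ (swapIn i j k) (swapOut i j k) ≤ weight i j k * Ψ (swapIn i j k) (swapOut i j k)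
          term-≤ i j k with supported i j k
          ... | _   , inj₁ w≡0  rewrite w≡0 = ≤-reflexive (trans (*-zeroˡ (Φ (swapIn i j k) (swapOut i j k))) (sym (*-zeroˡ (Ψ (swapIn i j k) (swapOut i j k)))))
          ... | 0≤w , inj₂ good = *-monoˡ-≤-0≤ 0≤w (Φ≤Ψ _ _ good)

  -- The family of swaps of Arya et al.

  1+1/_ : ℕ → ℚ
  1+1/ ℓ = 1ℚ + inv (ℕ→ℚ ℓ)

  3+2/_ : ℕ → ℚ
  3+2/ ℓ = 1ℚ + (1+1/ ℓ + 1+1/ ℓ)

  module SwapFamily {m : ℕ} (ℓ : ℕ) (1≤ℓ : 1 ℕ.≤ ℓ) (S O : Fin m → Bool) (η : Fin m → Fin m)
    (η∈S : ∀ o → S (η o) ≡ true) (η-fixes-S : ∀ s → S s ≡ true → η s ≡ s) (∣S∣≡∣O∣ : count S ≡ count O) where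

    record IsGoodSwap (A* A : Fin m → Bool) : Set where
      field
        out⊆S       : A ⊆ᵇ S
        in-out-of-S : ∀ i → A* i ≡ true → S i ≡ false
        ∣out∣≡∣in∣   : count A ≡ count A*
        ∣out∣≤ℓ      : count A ℕ.≤ ℓ
        keeps-η     : ∀ o → O o ≡ true → A* o ≡ false → A (η o) ≡ false

    deg : Fin m → ℕ
    deg t = count (λ o → O o ∧ (η o == t))

    deg-η-pos : ∀ o → O o ≡ true → 1 ℕ.≤ deg (η o)
    deg-η-pos o Oo = count-pos o (cong₂ _∧_ Oo (==-refl (η o)))

    deg-pos⇒∈S : ∀ t → 1 ℕ.≤ deg t → S t ≡ true
    deg-pos⇒∈S t 1≤deg with o , e ← count-pos⇒∃ 1≤deg =
      subst (λ x → S x ≡ true) (==⇒≡ (Boolₚ.∧-conicalʳ (O o) _ e)) (η∈S o)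

    sum-deg : sum (λ t → ℕ→ℚ (deg t)) ≡ ℕ→ℚ (count O)
    sum-deg = begin
      sum (λ t → ℕ→ℚ (deg t))                         ≡⟨ sum-cong (λ t → sum-𝟙 (λ o → O o ∧ (η o == t))) ⟨
      sum (λ t → sum (λ o → 𝟙 (O o ∧ (η o == t))))   ≡⟨ sum-comm (λ t o → 𝟙 (O o ∧ (η o == t))) ⟩
      sum (λ o → sum (λ t → 𝟙 (O o ∧ (η o == t))))   ≡⟨ sum-cong counted-once ⟩
      sum (λ o → 𝟙 (O o))                            ≡⟨ sum-𝟙 O ⟩
      ℕ→ℚ (count O)                                  ∎
      where
        open ≡-Reasoning
        counted-once : ∀ o → sum (λ t → 𝟙 (O o ∧ (η o == t))) ≡ 𝟙 (O o)
        counted-once o = trans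
          (sum-single (η o) (λ t t≢ηo → cong 𝟙 (trans (cong (O o ∧_) (≢⇒==-false (λ e → t≢ηo (sym e)))) (Boolₚ.∧-zeroʳ (O o)))))
          (cong 𝟙 (trans (cong (O o ∧_) (==-refl (η o))) (Boolₚ.∧-identityʳ (O o))))

    private
      isZero : ℕ → Bool
      isZero zero    = true
      isZero (suc _) = false

    matched : Fin m → Bool
    matched t = not (isZero (deg t))

    idle : Fin m → Bool
    idle s = S s ∧ isZero (deg s)

    idle⇒deg≡0 : ∀ s → idle s ≡ true → deg s ≡ 0
    idle⇒deg≡0 s e with deg s | Boolₚ.∧-conicalʳ (S s) _ e
    ... | zero | _ = refl

    deg-pos⇒¬idle : ∀ s → 1 ℕ.≤ deg s → idle s ≡ false
    deg-pos⇒¬idle s 1≤deg with deg s | 1≤deg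
    ... | suc _ | _ = Boolₚ.∧-zeroʳ (S s)

    idle⇒∉O : ∀ s → idle s ≡ true → O s ≡ false
    idle⇒∉O s e with O s in Os
    ... | false = refl
    ... | true with () ← ℕₚ.<⇒≢ (subst (λ x → 1 ℕ.≤ deg x) (η-fixes-S s (Boolₚ.∧-conicalˡ _ _ e)) (deg-η-pos s Os))
                                 (sym (idle⇒deg≡0 s e))

    private
      excess+𝟙matched : ∀ t → ℕ→ℚ (deg t ℕ.∸ 1) + 𝟙 (matched t) ≡ ℕ→ℚ (deg t)
      excess+𝟙matched t with deg t
      ... | zero  = refl
      ... | suc d = trans (+-comm (ℕ→ℚ d) 1ℚ) (sym (ℕ→ℚ-+ 1 d))

      𝟙matched+𝟙idle : ∀ t → 𝟙 (matched t) + 𝟙 (idle t) ≡ 𝟙 (S t)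
      𝟙matched+𝟙idle t with deg t in deg≡ | S t in St
      ... | zero  | true  = refl
      ... | zero  | false = refl
      ... | suc d | true  = refl
      ... | suc d | false with () ← trans (sym St) (deg-pos⇒∈S t (subst (1 ℕ.≤_) (sym deg≡) (s≤s z≤n)))

      count-sum : (f : Fin m → ℚ) (P : Fin m → Bool) → sum (λ t → f t + 𝟙 (P t)) ≡ sum f + ℕ→ℚ (count P)
      count-sum f P = trans (sum-distrib-+ f (λ t → 𝟙 (P t))) (cong (sum f +_) (sum-𝟙 P))

      excess+matched≡∣O∣ : sumℕ (λ t → deg t ℕ.∸ 1) ℕ.+ count matched ≡ count O
      excess+matched≡∣O∣ = ℕ→ℚ-injective (begin
        ℕ→ℚ (sumℕ (λ t → deg t ℕ.∸ 1) ℕ.+ count matched)             ≡⟨ ℕ→ℚ-+ (sumℕ (λ t → deg t ℕ.∸ 1)) (count matched) ⟩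
        ℕ→ℚ (sumℕ (λ t → deg t ℕ.∸ 1)) + ℕ→ℚ (count matched)         ≡⟨ cong (_+ ℕ→ℚ (count matched)) (ℕ→ℚ-sum (λ t → deg t ℕ.∸ 1)) ⟩
        sum (λ t → ℕ→ℚ (deg t ℕ.∸ 1)) + ℕ→ℚ (count matched)            ≡⟨ count-sum (λ t → ℕ→ℚ (deg t ℕ.∸ 1)) matched ⟨
        sum (λ t → ℕ→ℚ (deg t ℕ.∸ 1) + 𝟙 (matched t))                  ≡⟨ sum-cong excess+𝟙matched ⟩
        sum (λ t → ℕ→ℚ (deg t))                                        ≡⟨ sum-deg ⟩
        ℕ→ℚ (count O)                                                  ∎)
        where open ≡-Reasoning

      matched+idle≡∣O∣ : count matched ℕ.+ count idle ≡ count O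
      matched+idle≡∣O∣ = ℕ→ℚ-injective (begin
        ℕ→ℚ (count matched ℕ.+ count idle)       ≡⟨ ℕ→ℚ-+ (count matched) (count idle) ⟩
        ℕ→ℚ (count matched) + ℕ→ℚ (count idle)  ≡⟨ cong₂ _+_ (sum-𝟙 matched) (sum-𝟙 idle) ⟨
        sum (λ t → 𝟙 (matched t)) + sum (λ t → 𝟙 (idle t)) ≡⟨ sum-distrib-+ (λ t → 𝟙 (matched t)) (λ t → 𝟙 (idle t)) ⟨
        sum (λ t → 𝟙 (matched t) + 𝟙 (idle t))  ≡⟨ sum-cong 𝟙matched+𝟙idle ⟩
        sum (λ t → 𝟙 (S t))                     ≡⟨ sum-𝟙 S ⟩
        ℕ→ℚ (count S)                           ≡⟨ cong ℕ→ℚ ∣S∣≡∣O∣ ⟩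
        ℕ→ℚ (count O)                           ∎)
        where open ≡-Reasoning

    sum-excess≡∣idle∣ : sumℕ (λ t → deg t ℕ.∸ 1) ≡ count idle
    sum-excess≡∣idle∣ = ℕₚ.+-cancelʳ-≡ (count matched) _ _
      (trans excess+matched≡∣O∣ (trans (sym matched+idle≡∣O∣) (ℕₚ.+-comm (count matched) (count idle))))

    abstract
      chunking : DisjointSubsetsOfSizes idle (λ t → deg t ℕ.∸ 1)
      chunking = disjoint-subsets-of-sizes idle (λ t → deg t ℕ.∸ 1) (ℕₚ.≤-reflexive sum-excess≡∣idle∣)

    chunk : Fin m → Fin m → Bool
    chunk = proj₁ chunking

    chunk⊆idle : ∀ t → chunk t ⊆ᵇ idle
    chunk⊆idle = proj₁ (proj₂ chunking)

    ∣chunk∣ : ∀ t → count (chunk t) ≡ deg t ℕ.∸ 1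
    ∣chunk∣ = proj₁ (proj₂ (proj₂ chunking))

    chunk-disjoint : ∀ t t′ b → chunk t b ≡ true → chunk t′ b ≡ true → t ≡ t′
    chunk-disjoint = proj₂ (proj₂ (proj₂ chunking))

    chunk⇒∈S : ∀ t b → chunk t b ≡ true → S b ≡ true
    chunk⇒∈S t b e = Boolₚ.∧-conicalˡ _ _ (chunk⊆idle t b e)

    chunk⇒∉O : ∀ t b → chunk t b ≡ true → O b ≡ false
    chunk⇒∉O t b e = idle⇒∉O b (chunk⊆idle t b e)

    deg-pos⇒∉chunk : ∀ t b → 1 ℕ.≤ deg b → chunk t b ≡ false
    deg-pos⇒∉chunk t b 1≤deg with chunk t b in e
    ... | false = refl
    ... | true with () ← trans (sym (deg-pos⇒¬idle b 1≤deg)) (chunk⊆idle t b e)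

    captured : Fin m → Fin m → Bool
    captured t o = O o ∧ (η o == t) ∧ not (S o)

    captured⇒η≡ : ∀ t o → captured t o ≡ true → η o ≡ t
    captured⇒η≡ t o e = ==⇒≡ (Boolₚ.∧-conicalˡ _ _ (Boolₚ.∧-conicalʳ (O o) _ e))

    captured⇒∉S : ∀ t o → captured t o ≡ true → S o ≡ false
    captured⇒∉S t o e = Boolₚ.not-injective (Boolₚ.∧-conicalʳ (η o == t) _ (Boolₚ.∧-conicalʳ (O o) _ e))

    captured⇒matched : ∀ t o → captured t o ≡ true → 1 ℕ.≤ deg t
    captured⇒matched t o e = subst (λ x → 1 ℕ.≤ deg x) (captured⇒η≡ t o e) (deg-η-pos o (Boolₚ.∧-conicalˡ _ _ e))

    ∣captured∣≤deg : ∀ t → count (captured t) ℕ.≤ deg t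
    ∣captured∣≤deg t = count-mono (λ o e → cong₂ _∧_ (Boolₚ.∧-conicalˡ (O o) _ e) (Boolₚ.∧-conicalˡ (η o == t) (not (S o)) (Boolₚ.∧-conicalʳ (O o) _ e)))

    private
      𝟙captured+𝟙self≡𝟙captor : ∀ t o → 𝟙 (captured t o) + 𝟙 ((o == t) ∧ (O t ∧ S t)) ≡ 𝟙 (O o ∧ (η o == t))
      𝟙captured+𝟙self≡𝟙captor t o with o Finₚ.≟ t
      ... | yes refl with S o in So
      ...   | true  rewrite η-fixes-S o So | ==-refl o with O o
      ...     | true  = refl
      ...     | false = refl
      𝟙captured+𝟙self≡𝟙captor t o | yes refl | false with O o | η o == o
      ...     | true  | true  = refl
      ...     | true  | false = refl
      ...     | false | _     = refl
      𝟙captured+𝟙self≡𝟙captor t o | no o≢t with S o in So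
      ...   | true  rewrite η-fixes-S o So | ≢⇒==-false o≢t with O o
      ...     | true  = refl
      ...     | false = refl
      𝟙captured+𝟙self≡𝟙captor t o | no o≢t | false with O o | η o == t
      ...     | true  | true  = refl
      ...     | true  | false = refl
      ...     | false | _     = refl

    ∣captured∣+𝟙self≡deg : ∀ t → ℕ→ℚ (count (captured t)) + 𝟙 (O t ∧ S t) ≡ ℕ→ℚ (deg t)
    ∣captured∣+𝟙self≡deg t = begin
      ℕ→ℚ (count (captured t)) + 𝟙 (O t ∧ S t)                                ≡⟨ cong₂ _+_ (sum-𝟙 (captured t)) (sum-𝟙-==-∧ t (O t ∧ S t)) ⟨
      sum (λ o → 𝟙 (captured t o)) + sum (λ o → 𝟙 ((o == t) ∧ (O t ∧ S t)))  ≡⟨ sum-distrib-+ (λ o → 𝟙 (captured t o)) _ ⟨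
      sum (λ o → 𝟙 (captured t o) + 𝟙 ((o == t) ∧ (O t ∧ S t)))              ≡⟨ sum-cong (𝟙captured+𝟙self≡𝟙captor t) ⟩
      sum (λ o → 𝟙 (O o ∧ (η o == t)))                                       ≡⟨ sum-𝟙 (λ o → O o ∧ (η o == t)) ⟩
      ℕ→ℚ (deg t)                                                            ∎
      where open ≡-Reasoning

    -- A median of O ∩ S captures itself and is never swapped in, so it must stay.
    swappedOut : Fin m → Fin m → Bool
    swappedOut t s = ((s == t) ∨ chunk t s) ∧ not (O s)

    private
      𝟙swappedOut≡ : ∀ t s → 1 ℕ.≤ deg t → 𝟙 (swappedOut t s) ≡ 𝟙 ((s == t) ∧ not (O t)) + 𝟙 (chunk t s)
      𝟙swappedOut≡ t s 1≤deg with s Finₚ.≟ t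
      ... | yes refl rewrite deg-pos⇒∉chunk s s 1≤deg with O s
      ...   | true  = refl
      ...   | false = refl
      𝟙swappedOut≡ t s 1≤deg | no s≢t with chunk t s in e
      ...   | true rewrite chunk⇒∉O t s e = refl
      ...   | false = refl

    ∣swappedOut∣≡∣captured∣ : ∀ t → 1 ℕ.≤ deg t → count (swappedOut t) ≡ count (captured t)
    ∣swappedOut∣≡∣captured∣ t 1≤deg = ℕ→ℚ-injective (begin
      ℕ→ℚ (count (swappedOut t))                              ≡⟨ sum-𝟙 (swappedOut t) ⟨
      sum (λ s → 𝟙 (swappedOut t s))                          ≡⟨ sum-cong (λ s → 𝟙swappedOut≡ t s 1≤deg) ⟩
      sum (λ s → 𝟙 ((s == t) ∧ not (O t)) + 𝟙 (chunk t s))   ≡⟨ sum-distrib-+ (λ s → 𝟙 ((s == t) ∧ not (O t))) (λ s → 𝟙 (chunk t s)) ⟩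
      sum (λ s → 𝟙 ((s == t) ∧ not (O t))) + sum (λ s → 𝟙 (chunk t s))
          ≡⟨ cong₂ _+_ (sum-𝟙-==-∧ t (not (O t))) (trans (sum-𝟙 (chunk t)) (cong ℕ→ℚ (∣chunk∣ t))) ⟩
      𝟙 (not (O t)) + ℕ→ℚ (deg t ℕ.∸ 1)                       ≡⟨ cong (𝟙 (not (O t)) +_) (ℕ→ℚ-∸ 1≤deg) ⟩
      𝟙 (not (O t)) + (ℕ→ℚ (deg t) - 1ℚ)                      ≡⟨ 𝟙-not (O t) (ℕ→ℚ (deg t)) ⟩
      ℕ→ℚ (deg t) - 𝟙 (O t)                                   ≡⟨ cong (λ b → ℕ→ℚ (deg t) - 𝟙 b) (Boolₚ.∧-identityʳ (O t)) ⟨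
      ℕ→ℚ (deg t) - 𝟙 (O t ∧ true)                            ≡⟨ cong (λ b → ℕ→ℚ (deg t) - 𝟙 (O t ∧ b)) (deg-pos⇒∈S t 1≤deg) ⟨
      ℕ→ℚ (deg t) - 𝟙 (O t ∧ S t)                             ≡⟨ cong (_- 𝟙 (O t ∧ S t)) (∣captured∣+𝟙self≡deg t) ⟨
      (ℕ→ℚ (count (captured t)) + 𝟙 (O t ∧ S t)) - 𝟙 (O t ∧ S t)
          ≡⟨ solve 2 (λ x y → (x :+ y) :- y := x) refl (ℕ→ℚ (count (captured t))) (𝟙 (O t ∧ S t)) ⟩
      ℕ→ℚ (count (captured t))                                ∎)
      where
        open ≡-Reasoning
        𝟙-not : ∀ b x → 𝟙 (not b) + (x - 1ℚ) ≡ x - 𝟙 b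
        𝟙-not true  x = +-identityˡ _
        𝟙-not false x = solve 1 (λ x → con 1ℚ :+ (x :- con 1ℚ) := x :- con 0ℚ) refl x

    light-swap-good : ∀ t → 1 ℕ.≤ deg t → deg t ℕ.≤ ℓ → IsGoodSwap (captured t) (swappedOut t)
    light-swap-good t 1≤deg deg≤ℓ = record
      { out⊆S       = out⊆S
      ; in-out-of-S = captured⇒∉S t
      ; ∣out∣≡∣in∣   = ∣swappedOut∣≡∣captured∣ t 1≤deg
      ; ∣out∣≤ℓ      = ℕₚ.≤-trans (ℕₚ.≤-reflexive (∣swappedOut∣≡∣captured∣ t 1≤deg)) (ℕₚ.≤-trans (∣captured∣≤deg t) deg≤ℓ)
      ; keeps-η     = keeps-η
      }
      where
        out⊆S : swappedOut t ⊆ᵇ S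
        out⊆S s e with s Finₚ.≟ t
        ... | yes refl = deg-pos⇒∈S s 1≤deg
        ... | no s≢t = chunk⇒∈S t s (Boolₚ.∧-conicalˡ _ _ e)
        keeps-η : ∀ o → O o ≡ true → captured t o ≡ false → swappedOut t (η o) ≡ false
        keeps-η o Oo ¬captured with η o Finₚ.≟ t
        ... | no ηo≢t rewrite deg-pos⇒∉chunk t (η o) (deg-η-pos o Oo) = refl
        ... | yes ηo≡t with S o in So
        ...   | true rewrite η-fixes-S o So | Oo = refl
        ...   | false rewrite Oo with () ← ¬captured

    heavy-swap-good : ∀ t o b → captured t o ≡ true → chunk t b ≡ true → IsGoodSwap ⁅ o ⁆ᵇ ⁅ b ⁆ᵇ
    heavy-swap-good t o b captured-o chunk-b = record
      { out⊆S       = λ s e → subst (λ x → S x ≡ true) (sym (==⇒≡ e)) (chunk⇒∈S t b chunk-b)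
      ; in-out-of-S = λ o′ e → subst (λ x → S x ≡ false) (sym (==⇒≡ e)) (captured⇒∉S t o captured-o)
      ; ∣out∣≡∣in∣   = trans (count-⁅⁆ b) (sym (count-⁅⁆ o))
      ; ∣out∣≤ℓ      = ℕₚ.≤-trans (ℕₚ.≤-reflexive (count-⁅⁆ b)) 1≤ℓ
      ; keeps-η     = λ o′ Oo′ _ → ≢⇒==-false (λ ηo′≡b → ℕₚ.<⇒≢ (subst (λ x → 1 ℕ.≤ deg x) ηo′≡b (deg-η-pos o′ Oo′))
                                                                   (sym (idle⇒deg≡0 b (chunk⊆idle t b chunk-b))))
      }

    data Load : Set where
      unmatched light heavy : Load

    load : Fin m → Load
    load t with deg t
    ... | zero = unmatched
    ... | suc d with suc d ℕₚ.≤? ℓ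
    ...   | yes _ = light
    ...   | no  _ = heavy

    load-unmatched : ∀ t → load t ≡ unmatched → deg t ≡ 0
    load-unmatched t e with deg t
    ... | zero = refl
    ... | suc d with suc d ℕₚ.≤? ℓ
    load-unmatched t () | suc d | yes _
    load-unmatched t () | suc d | no _

    load-light : ∀ t → load t ≡ light → 1 ℕ.≤ deg t × deg t ℕ.≤ ℓ
    load-light t e with deg t
    load-light t () | zero
    ... | suc d with suc d ℕₚ.≤? ℓ
    ...   | yes d<ℓ = s≤s z≤n , d<ℓ
    load-light t () | suc d | no _

    load-heavy : ∀ t → load t ≡ heavy → ℓ ℕ.< deg t
    load-heavy t e with deg t
    load-heavy t () | zero
    ... | suc d with suc d ℕₚ.≤? ℓ
    load-heavy t () | suc d | yes _
    ...   | no ℓ≮d = ℕₚ.≰⇒> ℓ≮d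

    1≤1+1/ℓ : 1ℚ ≤ 1+1/ ℓ
    1≤1+1/ℓ = ≤-trans (≤-reflexive (sym (+-identityʳ 1ℚ))) (+-monoʳ-≤ 1ℚ (<⇒≤ (inv-pos (ℕ→ℚ-pos 1≤ℓ))))

    0≤1+1/ℓ : 0ℚ ≤ 1+1/ ℓ
    0≤1+1/ℓ = ≤-trans (<⇒≤ 0<1) 1≤1+1/ℓ

    1≤3+2/ℓ : 1ℚ ≤ 3+2/ ℓ
    1≤3+2/ℓ = ≤-trans (≤-reflexive (sym (+-identityʳ 1ℚ))) (+-monoʳ-≤ 1ℚ (+-mono-≤ 0≤1+1/ℓ 0≤1+1/ℓ))

    0≤3+2/ℓ : 0ℚ ≤ 3+2/ ℓ
    0≤3+2/ℓ = ≤-trans (<⇒≤ 0<1) 1≤3+2/ℓ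

    heavy-weight : Fin m → ℚ
    heavy-weight t = inv (ℕ→ℚ (deg t ℕ.∸ 1))

    module _ {t : Fin m} (t-heavy : load t ≡ heavy) where

      private
        ℓ≤excess : ℓ ℕ.≤ deg t ℕ.∸ 1
        ℓ≤excess = ℕₚ.∸-monoˡ-≤ 1 (load-heavy t t-heavy)

        excess-pos : 0ℚ < ℕ→ℚ (deg t ℕ.∸ 1)
        excess-pos = ℕ→ℚ-pos (ℕₚ.≤-trans 1≤ℓ ℓ≤excess)

      heavy-weight-pos : 0ℚ < heavy-weight t
      heavy-weight-pos = inv-pos excess-pos

      heavy-weight*excess≡1 : heavy-weight t * ℕ→ℚ (deg t ℕ.∸ 1) ≡ 1ℚ
      heavy-weight*excess≡1 = inv-inverseˡ _ (pos⇒≢0 excess-pos)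

      heavy-weight*∣captured∣≤1+1/ℓ : heavy-weight t * ℕ→ℚ (count (captured t)) ≤ 1+1/ ℓ
      heavy-weight*∣captured∣≤1+1/ℓ = begin
        heavy-weight t * ℕ→ℚ (count (captured t))         ≤⟨ *-monoˡ-≤-0≤ (<⇒≤ heavy-weight-pos) (ℕ→ℚ-mono-≤ (∣captured∣≤deg t)) ⟩
        heavy-weight t * ℕ→ℚ (deg t)                      ≡⟨ cong (heavy-weight t *_) deg≡excess+1 ⟩
        heavy-weight t * (ℕ→ℚ (deg t ℕ.∸ 1) + 1ℚ)          ≡⟨ *-distribˡ-+ (heavy-weight t) _ 1ℚ ⟩
        heavy-weight t * ℕ→ℚ (deg t ℕ.∸ 1) + heavy-weight t * 1ℚ ≡⟨ cong₂ _+_ heavy-weight*excess≡1 (*-identityʳ (heavy-weight t)) ⟩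
        1ℚ + heavy-weight t                               ≤⟨ +-monoʳ-≤ 1ℚ (inv-antimono-≤ (ℕ→ℚ-pos 1≤ℓ) (ℕ→ℚ-mono-≤ ℓ≤excess)) ⟩
        1+1/ ℓ                                             ∎
        where
          open ≤-Reasoning
          deg≡excess+1 : ℕ→ℚ (deg t) ≡ ℕ→ℚ (deg t ℕ.∸ 1) + 1ℚ
          deg≡excess+1 = trans (cong ℕ→ℚ (sym (ℕₚ.m∸n+n≡m (ℕₚ.<⇒≤ (ℕₚ.≤-<-trans 1≤ℓ (load-heavy t t-heavy))))))
                               (ℕ→ℚ-+ (deg t ℕ.∸ 1) 1)

    -- The swaps of group t are indexed by (o, b).  A light group contributes one swap, stored at
    -- (t, t), of everything t captures against t and its chunk; a heavy group swaps each captured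
    -- median against each median of its chunk, with weight 1/(deg t − 1).
    weightAt : Load → Fin m → Fin m → Fin m → ℚ
    weightAt unmatched t o b = 0ℚ
    weightAt light     t o b = if (o == t) ∧ (b == t) then 1ℚ else 0ℚ
    weightAt heavy     t o b = if captured t o ∧ chunk t b then heavy-weight t else 0ℚ

    swapInAt : Load → Fin m → Fin m → Fin m → Fin m → Bool
    swapInAt light t o b = captured t
    swapInAt _     t o b = ⁅ o ⁆ᵇ

    swapOutAt : Load → Fin m → Fin m → Fin m → Fin m → Bool
    swapOutAt light t o b = swappedOut t
    swapOutAt _     t o b = ⁅ b ⁆ᵇ

    swaps : WeightedSwaps
    swaps = record
      { weight  = λ t → weightAt (load t) t
      ; swapIn  = λ t → swapInAt (load t) t
      ; swapOut = λ t → swapOutAt (load t) t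
      }

    open WeightedSwaps swaps public using (weightedSum; weightedSum-cong; weightedSum-+; weightedSum-*ˡ; weightedSum-sum; weightedSum-if; weightedSum-mono-≤)

    swaps-good : WeightedSwaps.SupportedOn swaps IsGoodSwap
    swaps-good t o b with load t in load≡
    ... | unmatched = ≤-refl , inj₁ refl
    ... | light with (o == t) ∧ (b == t)
    ...   | true  = <⇒≤ 0<1 , inj₂ (uncurry (light-swap-good t) (load-light t load≡))
    ...   | false = ≤-refl , inj₁ refl
    swaps-good t o b | heavy with captured t o in captured-o | chunk t b in chunk-b
    ...   | true  | true  = <⇒≤ (heavy-weight-pos load≡) , inj₂ (heavy-swap-good t o b captured-o chunk-b)
    ...   | true  | false = ≤-refl , inj₁ refl
    ...   | false | _     = ≤-refl , inj₁ refl

    groupSum : SwapFn m → Load → Fin m → ℚ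
    groupSum Φ c t = sum (λ o → sum (λ b → weightAt c t o b * Φ (swapInAt c t o b) (swapOutAt c t o b)))

    groupSum-unmatched : ∀ Φ t → groupSum Φ unmatched t ≡ 0ℚ
    groupSum-unmatched Φ t = sum-zero (λ o → sum-zero (λ b → *-zeroˡ (Φ ⁅ o ⁆ᵇ ⁅ b ⁆ᵇ)))

    groupSum-light : ∀ Φ t → groupSum Φ light t ≡ Φ (captured t) (swappedOut t)
    groupSum-light Φ t = begin
      groupSum Φ light t
        ≡⟨ sum-cong (λ o → sum-cong (λ b → indicator-* ((o == t) ∧ (b == t)))) ⟩
      sum (λ o → sum (λ b → if ⁅ t ⁆ᵇ o ∧ ⁅ t ⁆ᵇ b then 1ℚ * x else 0ℚ))
        ≡⟨ sum-if-∧ ⁅ t ⁆ᵇ ⁅ t ⁆ᵇ (λ _ → 1ℚ) (λ _ → x) ⟩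
      sum (λ o → if ⁅ t ⁆ᵇ o then 1ℚ else 0ℚ) * sum (λ b → if ⁅ t ⁆ᵇ b then x else 0ℚ)
        ≡⟨ cong₂ _*_ (sum-if ⁅ t ⁆ᵇ 1ℚ) (sum-if ⁅ t ⁆ᵇ x) ⟩
      (1ℚ * ℕ→ℚ (count ⁅ t ⁆ᵇ)) * (x * ℕ→ℚ (count ⁅ t ⁆ᵇ))
        ≡⟨ cong (λ n → (1ℚ * ℕ→ℚ n) * (x * ℕ→ℚ n)) (count-⁅⁆ t) ⟩
      (1ℚ * 1ℚ) * (x * 1ℚ)
        ≡⟨ solve 1 (λ x → (con 1ℚ :* con 1ℚ) :* (x :* con 1ℚ) := x) refl x ⟩
      x ∎
      where
        open ≡-Reasoning
        x = Φ (captured t) (swappedOut t)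
        indicator-* : ∀ p → (if p then 1ℚ else 0ℚ) * x ≡ (if p then 1ℚ * x else 0ℚ)
        indicator-* true  = refl
        indicator-* false = *-zeroˡ x

    groupSum-heavy : ∀ Φ t (f g : Fin m → ℚ) → (∀ o b → Φ ⁅ o ⁆ᵇ ⁅ b ⁆ᵇ ≡ f o * g b) →
      groupSum Φ heavy t ≡ heavy-weight t * (sum (λ o → if captured t o then f o else 0ℚ) * sum (λ b → if chunk t b then g b else 0ℚ))
    groupSum-heavy Φ t f g Φ≡f*g = begin
      groupSum Φ heavy t
        ≡⟨ sum-cong (λ o → sum-cong (λ b → if-*ˡ (captured t o ∧ chunk t b) (heavy-weight t) (Φ ⁅ o ⁆ᵇ ⁅ b ⁆ᵇ))) ⟩
      sum (λ o → sum (λ b → heavy-weight t * (if captured t o ∧ chunk t b then Φ ⁅ o ⁆ᵇ ⁅ b ⁆ᵇ else 0ℚ)))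
        ≡⟨ sum-cong (λ o → *-distribˡ-sum (heavy-weight t) (λ b → if captured t o ∧ chunk t b then Φ ⁅ o ⁆ᵇ ⁅ b ⁆ᵇ else 0ℚ)) ⟨
      sum (λ o → heavy-weight t * sum (λ b → if captured t o ∧ chunk t b then Φ ⁅ o ⁆ᵇ ⁅ b ⁆ᵇ else 0ℚ))
        ≡⟨ *-distribˡ-sum (heavy-weight t) (λ o → sum (λ b → if captured t o ∧ chunk t b then Φ ⁅ o ⁆ᵇ ⁅ b ⁆ᵇ else 0ℚ)) ⟨
      heavy-weight t * sum (λ o → sum (λ b → if captured t o ∧ chunk t b then Φ ⁅ o ⁆ᵇ ⁅ b ⁆ᵇ else 0ℚ))
        ≡⟨ cong (heavy-weight t *_) (sum-cong (λ o → sum-cong (λ b → cong (λ y → if captured t o ∧ chunk t b then y else 0ℚ) (Φ≡f*g o b)))) ⟩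
      heavy-weight t * sum (λ o → sum (λ b → if captured t o ∧ chunk t b then f o * g b else 0ℚ))
        ≡⟨ cong (heavy-weight t *_) (sum-if-∧ (captured t) (chunk t) f g) ⟩
      heavy-weight t * (sum (λ o → if captured t o then f o else 0ℚ) * sum (λ b → if chunk t b then g b else 0ℚ)) ∎
      where open ≡-Reasoning

    swapIn-coverage : ∀ o → weightedSum (λ A* A → 𝟙 (A* o)) ≡ 𝟙 (O o ∧ not (S o))
    swapIn-coverage o = begin
      weightedSum Φ                       ≡⟨⟩
      sum (λ t → groupSum Φ (load t) t)   ≡⟨ sum-cong (λ t → per-group t (load t) refl) ⟩
      sum (λ t → 𝟙 (captured t o))        ≡⟨ sum-single (η o) (λ t t≢ηo → cong 𝟙 (not-captured t t≢ηo)) ⟩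
      𝟙 (captured (η o) o)                ≡⟨ cong (λ e → 𝟙 (O o ∧ e ∧ not (S o))) (==-refl (η o)) ⟩
      𝟙 (O o ∧ not (S o))                 ∎
      where
        open ≡-Reasoning
        Φ : SwapFn m
        Φ A* A = 𝟙 (A* o)
        not-captured : ∀ t → t ≢ η o → captured t o ≡ false
        not-captured t t≢ηo rewrite ≢⇒==-false {x = η o} (λ e → t≢ηo (sym e)) = Boolₚ.∧-zeroʳ (O o)
        per-group : ∀ t c → load t ≡ c → groupSum Φ c t ≡ 𝟙 (captured t o)
        per-group t unmatched load≡ with captured t o in captured-o
        ... | false = groupSum-unmatched Φ t
        ... | true with () ← ℕₚ.<⇒≢ (captured⇒matched t o captured-o) (sym (load-unmatched t load≡))
        per-group t light     load≡ = groupSum-light Φ t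
        per-group t heavy     load≡ = begin
          groupSum Φ heavy t
            ≡⟨ groupSum-heavy Φ t (λ o′ → 𝟙 (o == o′)) (λ _ → 1ℚ) (λ o′ b → sym (*-identityʳ _)) ⟩
          heavy-weight t * (sum (λ o′ → if captured t o′ then 𝟙 (o == o′) else 0ℚ) * sum (λ b → if chunk t b then 1ℚ else 0ℚ))
            ≡⟨ cong₂ (λ x y → heavy-weight t * (x * y)) (sum-𝟙-== o (captured t)) (sum-if (chunk t) 1ℚ) ⟩
          heavy-weight t * (𝟙 (captured t o) * (1ℚ * ℕ→ℚ (count (chunk t))))
            ≡⟨ cong (λ n → heavy-weight t * (𝟙 (captured t o) * (1ℚ * ℕ→ℚ n))) (∣chunk∣ t) ⟩
          heavy-weight t * (𝟙 (captured t o) * (1ℚ * ℕ→ℚ (deg t ℕ.∸ 1)))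
            ≡⟨ solve 3 (λ w x e → w :* (x :* (con 1ℚ :* e)) := x :* (w :* e)) refl (heavy-weight t) (𝟙 (captured t o)) (ℕ→ℚ (deg t ℕ.∸ 1)) ⟩
          𝟙 (captured t o) * (heavy-weight t * ℕ→ℚ (deg t ℕ.∸ 1))
            ≡⟨ trans (cong (𝟙 (captured t o) *_) (heavy-weight*excess≡1 load≡)) (*-identityʳ _) ⟩
          𝟙 (captured t o) ∎

    inGroup : Fin m → Fin m → Bool
    inGroup t s = ((s == t) ∧ matched s) ∨ chunk t s

    private
      deg-pos⇒matched : ∀ t → 1 ℕ.≤ deg t → matched t ≡ true
      deg-pos⇒matched t 1≤deg with deg t | 1≤deg
      ... | suc _ | _ = refl

      chunk⇒¬matched : ∀ t s → chunk t s ≡ true → matched s ≡ false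
      chunk⇒¬matched t s e rewrite idle⇒deg≡0 s (chunk⊆idle t s e) = refl

      inGroup-cases : ∀ t s → inGroup t s ≡ true → (t ≡ s × matched s ≡ true) ⊎ chunk t s ≡ true
      inGroup-cases t s e with (s == t) ∧ matched s in self
      ... | true  = inj₁ (sym (==⇒≡ (Boolₚ.∧-conicalˡ _ _ self)) , Boolₚ.∧-conicalʳ (s == t) _ self)
      ... | false = inj₂ e

    inGroup-unique : ∀ s t t′ → inGroup t s ≡ true → inGroup t′ s ≡ true → t ≡ t′
    inGroup-unique s t t′ e e′ with inGroup-cases t s e | inGroup-cases t′ s e′
    ... | inj₁ (t≡s , _)       | inj₁ (t′≡s , _)       = trans t≡s (sym t′≡s)
    ... | inj₁ (_ , matched-s) | inj₂ chunk-t′         with () ← trans (sym matched-s) (chunk⇒¬matched t′ s chunk-t′)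
    ... | inj₂ chunk-t         | inj₁ (_ , matched-s) with () ← trans (sym matched-s) (chunk⇒¬matched t s chunk-t)
    ... | inj₂ chunk-t         | inj₂ chunk-t′         = chunk-disjoint t t′ s chunk-t chunk-t′

    swapOut-coverage : ∀ s → weightedSum (λ A* A → 𝟙 (A s)) ≤ 1+1/ ℓ
    swapOut-coverage s = begin
      weightedSum Φ                          ≡⟨⟩
      sum (λ t → groupSum Φ (load t) t)      ≤⟨ sum-mono-≤ (λ t → per-group t (load t) refl) ⟩
      sum (λ t → 1+1/ ℓ * 𝟙 (inGroup t s))   ≡⟨ *-distribˡ-sum (1+1/ ℓ) (λ t → 𝟙 (inGroup t s)) ⟨
      1+1/ ℓ * sum (λ t → 𝟙 (inGroup t s))   ≤⟨ *-monoˡ-≤-0≤ 0≤1+1/ℓ (sum-𝟙-≤1 (λ t → inGroup t s) (inGroup-unique s)) ⟩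
      1+1/ ℓ * 1ℚ                            ≡⟨ *-identityʳ (1+1/ ℓ) ⟩
      1+1/ ℓ                                 ∎
      where
        open ≤-Reasoning
        Φ : SwapFn m
        Φ A* A = 𝟙 (A s)
        per-group : ∀ t c → load t ≡ c → groupSum Φ c t ≤ 1+1/ ℓ * 𝟙 (inGroup t s)
        per-group t unmatched load≡ = ≤-trans (≤-reflexive (groupSum-unmatched Φ t)) (*-0≤ 0≤1+1/ℓ (𝟙-nonNeg (inGroup t s)))
        per-group t light     load≡ = begin
          groupSum Φ light t       ≡⟨ groupSum-light Φ t ⟩
          𝟙 (swappedOut t s)       ≤⟨ 𝟙-mono-≤ swappedOut⇒inGroup ⟩
          𝟙 (inGroup t s)          ≤⟨ ≤-*-≥1 1≤1+1/ℓ (𝟙-nonNeg (inGroup t s)) ⟩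
          1+1/ ℓ * 𝟙 (inGroup t s)  ∎
          where
            swappedOut⇒inGroup : swappedOut t s ≡ true → inGroup t s ≡ true
            swappedOut⇒inGroup e with s Finₚ.≟ t
            ... | yes refl rewrite deg-pos⇒matched s (proj₁ (load-light s load≡)) = refl
            ... | no _     = Boolₚ.∧-conicalˡ _ _ e
        per-group t heavy     load≡ = begin
          groupSum Φ heavy t
            ≡⟨ groupSum-heavy Φ t (λ _ → 1ℚ) (λ b → 𝟙 (s == b)) (λ o b → sym (*-identityˡ _)) ⟩
          heavy-weight t * (sum (λ o → if captured t o then 1ℚ else 0ℚ) * sum (λ b → if chunk t b then 𝟙 (s == b) else 0ℚ))
            ≡⟨ cong₂ (λ x y → heavy-weight t * (x * y)) (sum-if (captured t) 1ℚ) (sum-𝟙-== s (chunk t)) ⟩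
          heavy-weight t * ((1ℚ * ℕ→ℚ (count (captured t))) * 𝟙 (chunk t s))
            ≡⟨ solve 3 (λ w c x → w :* ((con 1ℚ :* c) :* x) := (w :* c) :* x) refl (heavy-weight t) (ℕ→ℚ (count (captured t))) (𝟙 (chunk t s)) ⟩
          (heavy-weight t * ℕ→ℚ (count (captured t))) * 𝟙 (chunk t s)
            ≤⟨ *-monoʳ-≤-0≤ (𝟙-nonNeg (chunk t s)) (heavy-weight*∣captured∣≤1+1/ℓ load≡) ⟩
          1+1/ ℓ * 𝟙 (chunk t s)
            ≤⟨ *-monoˡ-≤-0≤ 0≤1+1/ℓ (𝟙-mono-≤ (λ e → trans (cong (((s == t) ∧ matched s) ∨_) e) (Boolₚ.∨-zeroʳ _))) ⟩
          1+1/ ℓ * 𝟙 (inGroup t s) ∎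

    swapOut-size : weightedSum (λ A* A → ℕ→ℚ (count A)) ≤ ℕ→ℚ (count O)
    swapOut-size = begin
      weightedSum Φ                      ≡⟨⟩
      sum (λ t → groupSum Φ (load t) t)  ≤⟨ sum-mono-≤ (λ t → per-group t (load t) refl) ⟩
      sum (λ t → ℕ→ℚ (deg t))            ≡⟨ sum-deg ⟩
      ℕ→ℚ (count O)                      ∎
      where
        open ≤-Reasoning
        Φ : SwapFn m
        Φ A* A = ℕ→ℚ (count A)
        per-group : ∀ t c → load t ≡ c → groupSum Φ c t ≤ ℕ→ℚ (deg t)
        per-group t unmatched load≡ = ≤-trans (≤-reflexive (groupSum-unmatched Φ t)) (ℕ→ℚ-nonNeg (deg t))
        per-group t light     load≡ = ≤-trans (≤-reflexive (trans (groupSum-light Φ t) (cong ℕ→ℚ (∣swappedOut∣≡∣captured∣ t (proj₁ (load-light t load≡))))))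
                                              (ℕ→ℚ-mono-≤ (∣captured∣≤deg t))
        per-group t heavy     load≡ = begin
          groupSum Φ heavy t
            ≡⟨ groupSum-heavy Φ t (λ _ → 1ℚ) (λ _ → 1ℚ) (λ o b → cong ℕ→ℚ (count-⁅⁆ b)) ⟩
          heavy-weight t * (sum (λ o → if captured t o then 1ℚ else 0ℚ) * sum (λ b → if chunk t b then 1ℚ else 0ℚ))
            ≡⟨ cong₂ (λ x y → heavy-weight t * (x * y)) (sum-if (captured t) 1ℚ) (trans (sum-if (chunk t) 1ℚ) (cong (λ n → 1ℚ * ℕ→ℚ n) (∣chunk∣ t))) ⟩
          heavy-weight t * ((1ℚ * ℕ→ℚ (count (captured t))) * (1ℚ * ℕ→ℚ (deg t ℕ.∸ 1)))
            ≡⟨ solve 3 (λ w c e → w :* ((con 1ℚ :* c) :* (con 1ℚ :* e)) := c :* (w :* e)) refl (heavy-weight t) (ℕ→ℚ (count (captured t))) (ℕ→ℚ (deg t ℕ.∸ 1)) ⟩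
          ℕ→ℚ (count (captured t)) * (heavy-weight t * ℕ→ℚ (deg t ℕ.∸ 1))
            ≡⟨ trans (cong (ℕ→ℚ (count (captured t)) *_) (heavy-weight*excess≡1 load≡)) (*-identityʳ _) ⟩
          ℕ→ℚ (count (captured t))
            ≤⟨ ℕ→ℚ-mono-≤ (∣captured∣≤deg t) ⟩
          ℕ→ℚ (deg t) ∎

  -- The change of a point's cost under a swap

  outlier-change-≤ : ∀ (out-σ : Bool) {new r p} → new ≤ p → (out-σ ≡ false → new ≤ r) →
                     new - r ≤ (if out-σ then p - r else 0ℚ)
  outlier-change-≤ true  {r = r} new≤p _ = +-monoˡ-≤ (- r) new≤p
  outlier-change-≤ false {r = r} _ new≤r = ≤-trans (+-monoˡ-≤ (- r) (new≤r refl)) (≤-reflexive (+-inverseʳ r))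

  inlier-change-≤ : ∀ (in-o out-σ : Bool) {new r D} → 0ℚ ≤ D →
                    (in-o ≡ true → new ≤ D) → (in-o ≡ false → new ≤ (D + D) + r) → (out-σ ≡ false → new ≤ r) →
                    new - r ≤ (if in-o then D - r else 0ℚ) + (if out-σ then D + D else 0ℚ)
  inlier-change-≤ true out-σ {new} {r} {D} 0≤D new≤D _ _ = begin
    new - r                                      ≤⟨ +-monoˡ-≤ (- r) (new≤D refl) ⟩
    D - r                                        ≡⟨ +-identityʳ (D - r) ⟨
    (D - r) + 0ℚ                                 ≤⟨ +-monoʳ-≤ (D - r) (nonNeg out-σ) ⟩
    (D - r) + (if out-σ then D + D else 0ℚ)      ∎
    where
      open ≤-Reasoning
      nonNeg : ∀ b → 0ℚ ≤ (if b then D + D else 0ℚ)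
      nonNeg true  = +-mono-≤ 0≤D 0≤D
      nonNeg false = ≤-refl
  inlier-change-≤ false true {new} {r} {D} _ _ new≤2D+r _ = begin
    new - r              ≤⟨ +-monoˡ-≤ (- r) (new≤2D+r refl) ⟩
    ((D + D) + r) - r    ≡⟨ solve 2 (λ D r → ((D :+ D) :+ r) :- r := con 0ℚ :+ (D :+ D)) refl D r ⟩
    0ℚ + (D + D)         ∎
    where open ≤-Reasoning
  inlier-change-≤ false false {r = r} _ _ _ new≤r = ≤-trans (+-monoˡ-≤ (- r) (new≤r refl)) (≤-reflexive (+-inverseʳ r))

  -- Local search on a k-median-with-outliers instance

  module LocalSearch {m n : ℕ} (d : Point m n → Point m n → ℕ) (pm : IsPseudometric d) where

    open Instance d
    open IsPseudometric pm renaming (sym to d-sym)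

    sumOver≡sum : ∀ X f → sumOver X f ≡ sum (λ j → if lookup X j then f j else 0ℚ)
    sumOver≡sum X f = trans (foldr-tabulate (λ j acc → (if lookup X j then f j else 0ℚ) + acc) 0ℚ (λ j → j))
                            (foldr-+≡sum (λ j → if lookup X j then f j else 0ℚ) (λ j → j))

    countOver≡count : ∀ X P → countOver X P ≡ count (λ j → lookup X j ∧ P j)
    countOver≡count X P = trans (foldr-tabulate (λ j acc → (if lookup X j ∧ P j then 1 else 0) ℕ.+ acc) 0 (λ j → j))
                                (foldr-+≡count (λ j → lookup X j ∧ P j) (λ j → j))

    module _ {p : ℚ} (j : Fin n) (X : Subset m) where

      private
        dₚ≡foldr : dₚ p j X ≡ Vector.foldr (λ i acc → if lookup X i then (ℕ→ℚ (dist j i) ⊓ p) ⊓ acc else acc) p (λ i → i)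
        dₚ≡foldr = foldr-tabulate (λ i acc → if lookup X i then (ℕ→ℚ (dist j i) ⊓ p) ⊓ acc else acc) p (λ i → i)

      dₚ≤p : dₚ p j X ≤ p
      dₚ≤p = ≤-trans (≤-reflexive dₚ≡foldr) (foldr-⊓≤init (lookup X) (λ i → ℕ→ℚ (dist j i) ⊓ p) p (λ i → i))

      dₚ≤ : ∀ i → lookup X i ≡ true → dₚ p j X ≤ ℕ→ℚ (dist j i) ⊓ p
      dₚ≤ i i∈X = ≤-trans (≤-reflexive dₚ≡foldr) (foldr-⊓≤ (lookup X) (λ i → ℕ→ℚ (dist j i) ⊓ p) p (λ i → i) i i∈X)

      ≤dₚ : ∀ {L} → L ≤ p → (∀ i → lookup X i ≡ true → L ≤ ℕ→ℚ (dist j i) ⊓ p) → L ≤ dₚ p j X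
      ≤dₚ L≤p L≤d = ≤-trans (foldr-⊓-glb (lookup X) (λ i → ℕ→ℚ (dist j i) ⊓ p) p (λ i → i) L≤p L≤d) (≤-reflexive (sym dₚ≡foldr))

      dₚ-nonNeg : 0ℚ ≤ p → 0ℚ ≤ dₚ p j X
      dₚ-nonNeg 0≤p = ≤dₚ 0≤p (λ i _ → ⊓-glb (ℕ→ℚ-nonNeg (dist j i)) 0≤p)

    sumOver-mono : ∀ {X Y} {f : Fin n → ℚ} → lookup X ⊆ᵇ lookup Y → (∀ j → 0ℚ ≤ f j) → sumOver X f ≤ sumOver Y f
    sumOver-mono {X} {Y} {f} X⊆Y 0≤f = begin
      sumOver X f                                  ≡⟨ sumOver≡sum X f ⟩
      sum (λ j → if lookup X j then f j else 0ℚ)  ≤⟨ sum-mono-≤ (λ j → restrict-≤ j (lookup X j) refl) ⟩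
      sum (λ j → if lookup Y j then f j else 0ℚ)  ≡⟨ sumOver≡sum Y f ⟨
      sumOver Y f                                  ∎
      where
        open ≤-Reasoning
        restrict-≤ : ∀ j b → lookup X j ≡ b → (if b then f j else 0ℚ) ≤ (if lookup Y j then f j else 0ℚ)
        restrict-≤ j true  j∈X rewrite X⊆Y j j∈X = ≤-refl
        restrict-≤ j false _ with lookup Y j
        ... | true  = 0≤f j
        ... | false = ≤-refl

    ≤distSet : ∀ j X {L} → (∀ i → lookup X i ≡ true → L ℕ.≤ dist j i) → Σ[ i ∈ Fin m ] lookup X i ≡ true → L ℕ.≤ distSet j X
    ≤distSet j X {L} L≤d (i , i∈X) = ℕₚ.≤-trans
      (foldr-⊓ℕ-glb (lookup X) (dist j) (maxDist j) (λ i → i) (ℕₚ.≤-trans (L≤d i i∈X) dist≤maxDist) L≤d)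
      (ℕₚ.≤-reflexive (sym (foldr-tabulate (λ i acc → if lookup X i then dist j i ℕ.⊓ acc else acc) (maxDist j) (λ i → i))))
      where
        dist≤maxDist : dist j i ℕ.≤ maxDist j
        dist≤maxDist = ℕₚ.≤-trans (foldr-⊔-ub (dist j) (λ i → i) i) (ℕₚ.≤-reflexive (sym (foldr-tabulate (λ i acc → dist j i ℕ.⊔ acc) 0 (λ i → i))))

    module Nearest (X : Subset m) (X≠∅ : Σ[ i ∈ Fin m ] lookup X i ≡ true) where

      abstract
        nearest : Fin n → Fin m
        nearest j = proj₁ (minimiser (lookup X) (dist j) X≠∅)

        nearest∈X : ∀ j → lookup X (nearest j) ≡ true
        nearest∈X j = proj₁ (proj₂ (minimiser (lookup X) (dist j) X≠∅))

        nearest-≤ : ∀ j i → lookup X i ≡ true → dist j (nearest j) ℕ.≤ dist j i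
        nearest-≤ j = proj₂ (proj₂ (minimiser (lookup X) (dist j) X≠∅))

        project : Fin m → Fin m
        project o = if lookup X o then o else proj₁ (minimiser (lookup X) (λ s → d (inj₁ o) (inj₁ s)) X≠∅)

        project∈X : ∀ o → lookup X (project o) ≡ true
        project∈X o with lookup X o in o∈X
        ... | true  = o∈X
        ... | false = proj₁ (proj₂ (minimiser (lookup X) (λ s → d (inj₁ o) (inj₁ s)) X≠∅))

        project-fixes-X : ∀ o → lookup X o ≡ true → project o ≡ o
        project-fixes-X o o∈X rewrite o∈X = refl

        project-≤ : ∀ o s → lookup X s ≡ true → d (inj₁ o) (inj₁ (project o)) ℕ.≤ d (inj₁ o) (inj₁ s)
        project-≤ o s s∈X with lookup X o
        ... | true  = ℕₚ.≤-trans (ℕₚ.≤-reflexive (refl0 (inj₁ o))) z≤n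
        ... | false = proj₂ (proj₂ (minimiser (lookup X) (λ s → d (inj₁ o) (inj₁ s)) X≠∅)) s s∈X

      dist-project≤ : ∀ j o → dist j (project o) ℕ.≤ dist j o ℕ.+ dist j o ℕ.+ dist j (nearest j)
      dist-project≤ j o = begin
        d (inj₂ j) (inj₁ (project o))                                       ≤⟨ tri (inj₂ j) (inj₁ o) (inj₁ (project o)) ⟩
        d (inj₂ j) (inj₁ o) ℕ.+ d (inj₁ o) (inj₁ (project o))                ≤⟨ ℕₚ.+-monoʳ-≤ (dist j o) (project-≤ o (nearest j) (nearest∈X j)) ⟩
        d (inj₂ j) (inj₁ o) ℕ.+ d (inj₁ o) (inj₁ (nearest j))                ≤⟨ ℕₚ.+-monoʳ-≤ (dist j o) (tri (inj₁ o) (inj₂ j) (inj₁ (nearest j))) ⟩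
        dist j o ℕ.+ (d (inj₁ o) (inj₂ j) ℕ.+ dist j (nearest j))            ≡⟨ cong (λ x → dist j o ℕ.+ (x ℕ.+ dist j (nearest j))) (d-sym (inj₁ o) (inj₂ j)) ⟩
        dist j o ℕ.+ (dist j o ℕ.+ dist j (nearest j))                       ≡⟨ ℕₚ.+-assoc (dist j o) (dist j o) (dist j (nearest j)) ⟨
        dist j o ℕ.+ dist j o ℕ.+ dist j (nearest j)                         ∎
        where open ℕₚ.≤-Reasoning

    LocallyOptimal : (k ℓ : ℕ) (ε : ℚ) (t : ℕ) (p : ℚ) (S : Subset m) → Set
    LocallyOptimal k ℓ ε t p S = ∀ A* A → IsSwap ℓ S A* A → ¬ Improving k ε t p S A* A

    module Swaps {p : ℚ} (0≤p : 0ℚ ≤ p) (ℓ : ℕ) (1≤ℓ : 1 ℕ.≤ ℓ) (S O : Subset m)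
                 (S≠∅ : Σ[ i ∈ Fin m ] lookup S i ≡ true) (O≠∅ : Σ[ i ∈ Fin m ] lookup O i ≡ true) (∣S∣≡∣O∣ : ∣ S ∣ ≡ ∣ O ∣) where

      open Nearest S S≠∅ renaming (nearest to σ; nearest∈X to σ∈S; nearest-≤ to σ-≤; project to η; project∈X to η∈S;
                                   project-fixes-X to η-fixes-S; dist-project≤ to dist-η≤)
      open Nearest O O≠∅ using () renaming (nearest to o*; nearest∈X to o*∈O; nearest-≤ to o*-≤)
      open SwapFamily ℓ 1≤ℓ (lookup S) (lookup O) η η∈S η-fixes-S (trans (sym (∣p∣≡count S)) (trans ∣S∣≡∣O∣ (∣p∣≡count O))) public

      r : Fin n → ℚ
      r j = dₚ p j S

      D : Fin n → ℚ
      D j = ℕ→ℚ (dist j (o* j))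

      swapped : (A* A : Fin m → Bool) → Subset m
      swapped A* A = applySwap S (tabulate A*) (tabulate A)

      new : Fin n → (A* A : Fin m → Bool) → ℚ
      new j A* A = dₚ p j (swapped A* A)

      lookup-swapped : ∀ A* A i → lookup (swapped A* A) i ≡ (lookup S i ∨ A* i) ∧ not (A i)
      lookup-swapped A* A i
        rewrite lookup-─ (S ∪ tabulate A*) (tabulate A) i | lookup-∪ S (tabulate A*) i
              | Vecₚ.lookup∘tabulate A* i | Vecₚ.lookup∘tabulate A i = refl

      new≤ : ∀ j A* A i → (lookup S i ∨ A* i) ≡ true → A i ≡ false → new j A* A ≤ ℕ→ℚ (dist j i) ⊓ p
      new≤ j A* A i kept-or-in not-out =
        dₚ≤ j (swapped A* A) i (trans (lookup-swapped A* A i) (cong₂ (λ x y → x ∧ not y) kept-or-in not-out))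

      nearest⊓p≤r : ∀ j → ℕ→ℚ (dist j (σ j)) ⊓ p ≤ r j
      nearest⊓p≤r j = ≤dₚ j S (p⊓q≤q (ℕ→ℚ (dist j (σ j))) p) (λ i i∈S → ⊓-monoˡ-≤ p (ℕ→ℚ-mono-≤ (σ-≤ j i i∈S)))

      module _ {A* A : Fin m → Bool} (good : IsGoodSwap A* A) (j : Fin n) where

        open IsGoodSwap good

        private
          new≤r : A (σ j) ≡ false → new j A* A ≤ r j
          new≤r σ-kept = ≤-trans (new≤ j A* A (σ j) (cong (_∨ A* (σ j)) (σ∈S j)) σ-kept) (nearest⊓p≤r j)

          in⇒not-out : ∀ i → A* i ≡ true → A i ≡ false
          in⇒not-out i in-i with A i in out-i
          ... | false = refl
          ... | true with () ← trans (sym (in-out-of-S i in-i)) (out⊆S i out-i)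

        outlier-change : new j A* A - r j ≤ (if A (σ j) then p - r j else 0ℚ)
        outlier-change = outlier-change-≤ (A (σ j)) (dₚ≤p j (swapped A* A)) new≤r

        inlier-change : new j A* A - r j ≤ (if A* (o* j) then D j - r j else 0ℚ) + (if A (σ j) then D j + D j else 0ℚ)
        inlier-change = inlier-change-≤ (A* (o* j)) (A (σ j)) (ℕ→ℚ-nonNeg (dist j (o* j))) new≤D new≤2D+r new≤r
          where
            new≤D : A* (o* j) ≡ true → new j A* A ≤ D j
            new≤D in-o = ≤-trans (new≤ j A* A (o* j) (trans (cong (lookup S (o* j) ∨_) in-o) (Boolₚ.∨-zeroʳ (lookup S (o* j)))) (in⇒not-out (o* j) in-o))
                                 (p⊓q≤p (D j) p)
            -- j falls back on η (o* j), which survives the swap because o* j is not swapped in.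
            new≤2D+r : A* (o* j) ≡ false → new j A* A ≤ (D j + D j) + r j
            new≤2D+r not-in = begin
              new j A* A
                ≤⟨ new≤ j A* A (η (o* j)) (cong (_∨ A* (η (o* j))) (η∈S (o* j))) (keeps-η (o* j) (o*∈O j) not-in) ⟩
              ℕ→ℚ (dist j (η (o* j))) ⊓ p
                ≤⟨ ⊓-monoˡ-≤ p (ℕ→ℚ-mono-≤ (dist-η≤ j (o* j))) ⟩
              ℕ→ℚ (dist j (o* j) ℕ.+ dist j (o* j) ℕ.+ dist j (σ j)) ⊓ p
                ≡⟨ cong (_⊓ p) (trans (ℕ→ℚ-+ (dist j (o* j) ℕ.+ dist j (o* j)) (dist j (σ j))) (cong (_+ ℕ→ℚ (dist j (σ j))) (ℕ→ℚ-+ (dist j (o* j)) (dist j (o* j))))) ⟩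
              (D j + D j + ℕ→ℚ (dist j (σ j))) ⊓ p
                ≤⟨ ⊓-+-≤ (D j + D j) (ℕ→ℚ (dist j (σ j))) p (+-mono-≤ (ℕ→ℚ-nonNeg (dist j (o* j))) (ℕ→ℚ-nonNeg (dist j (o* j)))) ⟩
              (D j + D j) + ℕ→ℚ (dist j (σ j)) ⊓ p
                ≤⟨ +-monoʳ-≤ (D j + D j) (nearest⊓p≤r j) ⟩
              (D j + D j) + r j ∎
              where open ≤-Reasoning

      outlier-average : ∀ j → weightedSum (λ A* A → if A (σ j) then p - r j else 0ℚ) ≤ 1+1/ ℓ * p - r j
      outlier-average j = begin
        weightedSum (λ A* A → if A (σ j) then p - r j else 0ℚ)  ≡⟨ weightedSum-cong (λ A* A → if-0≡*𝟙 (A (σ j)) (p - r j)) ⟩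
        weightedSum (λ A* A → (p - r j) * 𝟙 (A (σ j)))         ≡⟨ weightedSum-*ˡ (p - r j) (λ A* A → 𝟙 (A (σ j))) ⟩
        (p - r j) * weightedSum (λ A* A → 𝟙 (A (σ j)))         ≤⟨ *-monoˡ-≤-0≤ (p≤q⇒0≤q-p (dₚ≤p {p = p} j S)) (swapOut-coverage (σ j)) ⟩
        (p - r j) * 1+1/ ℓ                                      ≤⟨ ≤-by-difference ((1+1/ ℓ - 1ℚ) * r j) (*-0≤ (p≤q⇒0≤q-p 1≤1+1/ℓ) (dₚ-nonNeg {p = p} j S 0≤p))
                                                                     (solve 3 (λ l p r → (l :* p :- r) :- ((p :- r) :* l) := (l :- con 1ℚ) :* r) refl (1+1/ ℓ) p (r j)) ⟩
        1+1/ ℓ * p - r j                                        ∎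
        where open ≤-Reasoning

      inlier-average : ∀ j → weightedSum (λ A* A → (if A* (o* j) then D j - r j else 0ℚ) + (if A (σ j) then D j + D j else 0ℚ))
                             ≤ 3+2/ ℓ * ℕ→ℚ (distSet j O) - r j
      inlier-average j = begin
        weightedSum (λ A* A → (if A* (o* j) then D j - r j else 0ℚ) + (if A (σ j) then D j + D j else 0ℚ))
          ≡⟨ weightedSum-cong (λ A* A → cong₂ _+_ (if-0≡*𝟙 (A* (o* j)) (D j - r j)) (if-0≡*𝟙 (A (σ j)) (D j + D j))) ⟩
        weightedSum (λ A* A → (D j - r j) * 𝟙 (A* (o* j)) + (D j + D j) * 𝟙 (A (σ j)))
          ≡⟨ weightedSum-+ (λ A* A → (D j - r j) * 𝟙 (A* (o* j))) (λ A* A → (D j + D j) * 𝟙 (A (σ j))) ⟩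
        weightedSum (λ A* A → (D j - r j) * 𝟙 (A* (o* j))) + weightedSum (λ A* A → (D j + D j) * 𝟙 (A (σ j)))
          ≡⟨ cong₂ _+_ (weightedSum-*ˡ (D j - r j) (λ A* A → 𝟙 (A* (o* j)))) (weightedSum-*ˡ (D j + D j) (λ A* A → 𝟙 (A (σ j)))) ⟩
        (D j - r j) * weightedSum (λ A* A → 𝟙 (A* (o* j))) + (D j + D j) * weightedSum (λ A* A → 𝟙 (A (σ j)))
          ≤⟨ +-mono-≤ (≤-trans (≤-reflexive (cong ((D j - r j) *_) (swapIn-coverage (o* j)))) (swapped-in (lookup S (o* j)) refl))
                      (*-monoˡ-≤-0≤ (+-mono-≤ (ℕ→ℚ-nonNeg (dist j (o* j))) (ℕ→ℚ-nonNeg (dist j (o* j)))) (swapOut-coverage (σ j))) ⟩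
        (D j - r j) + (D j + D j) * 1+1/ ℓ
          ≡⟨ solve 3 (λ D r l → (D :- r) :+ (D :+ D) :* l := (con 1ℚ :+ (l :+ l)) :* D :- r) refl (D j) (r j) (1+1/ ℓ) ⟩
        3+2/ ℓ * D j - r j
          ≤⟨ +-monoˡ-≤ (- r j) (*-monoˡ-≤-0≤ 0≤3+2/ℓ (ℕ→ℚ-mono-≤ (≤distSet j O (o*-≤ j) O≠∅))) ⟩
        3+2/ ℓ * ℕ→ℚ (distSet j O) - r j ∎
        where
          open ≤-Reasoning
          swapped-in : ∀ b → lookup S (o* j) ≡ b → (D j - r j) * 𝟙 (lookup O (o* j) ∧ not (lookup S (o* j))) ≤ D j - r j
          swapped-in true  o*∈S rewrite o*∈O j | o*∈S =
            ≤-trans (≤-reflexive (*-zeroʳ (D j - r j))) (p≤q⇒0≤q-p (≤-trans (dₚ≤ j S (o* j) o*∈S) (p⊓q≤p (D j) p)))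
          swapped-in false o*∉S rewrite o*∈O j | o*∉S = ≤-reflexive (*-identityʳ (D j - r j))

      good⇒IsSwap : ∀ {A* A} → IsGoodSwap A* A → IsSwap ℓ S (tabulate A*) (tabulate A)
      good⇒IsSwap {A*} {A} good =
        (λ {i} i∈A → lookup⇒∈ (out⊆S i (trans (sym (Vecₚ.lookup∘tabulate A i)) (∈⇒lookup i∈A)))) ,
        (λ {i} i∈A* → lookup⇒∈ (trans (Vecₚ.lookup-map i not S)
                                       (cong not (in-out-of-S i (trans (sym (Vecₚ.lookup∘tabulate A* i)) (∈⇒lookup i∈A*)))))) ,
        trans (∣tabulate∣≡count A) (trans ∣out∣≡∣in∣ (sym (∣tabulate∣≡count A*))) ,
        ℕₚ.≤-trans (ℕₚ.≤-reflexive (∣tabulate∣≡count A)) ∣out∣≤ℓ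
        where open IsGoodSwap good

      module _ (t : ℕ) (Z : Subset n) where

        private
          C : Fin n → Bool
          C = lookup (Cset t)

        costₚ≡ : ∀ X → costₚ t p X ≡ tenth + sum (λ j → if C j then dₚ p j X else 0ℚ)
        costₚ≡ X = cong (tenth +_) (sumOver≡sum (Cset t) (λ j → dₚ p j X))

        change : SwapFn m
        change A* A = sum (λ j → if C j then new j A* A - r j else 0ℚ)

        change≡ : ∀ A* A → change A* A ≡ costₚ t p (swapped A* A) - costₚ t p S
        change≡ A* A = begin
          sum (λ j → if C j then new j A* A - r j else 0ℚ)
            ≡⟨ sum-cong (λ j → if-sub (C j)) ⟩
          sum (λ j → (if C j then new j A* A else 0ℚ) - (if C j then r j else 0ℚ))
            ≡⟨ sum-sub (λ j → if C j then new j A* A else 0ℚ) (λ j → if C j then r j else 0ℚ) ⟩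
          sum (λ j → if C j then new j A* A else 0ℚ) - sum (λ j → if C j then r j else 0ℚ)
            ≡⟨ solve 3 (λ a b c → a :- b := (c :+ a) :- (c :+ b)) refl (sum (λ j → if C j then new j A* A else 0ℚ)) (sum (λ j → if C j then r j else 0ℚ)) tenth ⟩
          (tenth + sum (λ j → if C j then new j A* A else 0ℚ)) - (tenth + sum (λ j → if C j then r j else 0ℚ))
            ≡⟨ cong₂ _-_ (costₚ≡ (swapped A* A)) (costₚ≡ S) ⟨
          costₚ t p (swapped A* A) - costₚ t p S ∎
          where
            open ≡-Reasoning
            if-sub : ∀ b {x y} → (if b then x - y else 0ℚ) ≡ (if b then x else 0ℚ) - (if b then y else 0ℚ)
            if-sub true  = refl
            if-sub false = refl

        bound : Fin n → SwapFn m
        bound j A* A = if lookup Z j then (if A (σ j) then p - r j else 0ℚ)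
                       else (if A* (o* j) then D j - r j else 0ℚ) + (if A (σ j) then D j + D j else 0ℚ)

        average-bound : Fin n → ℚ
        average-bound j = if lookup Z j then 1+1/ ℓ * p - r j else 3+2/ ℓ * ℕ→ℚ (distSet j O) - r j

        change-≤ : ∀ A* A → IsGoodSwap A* A → change A* A ≤ sum (λ j → if C j then bound j A* A else 0ℚ)
        change-≤ A* A good = sum-mono-≤ (λ j → if-mono-≤ (C j) (per-point j))
          where
            per-point : ∀ j → new j A* A - r j ≤ bound j A* A
            per-point j with lookup Z j
            ... | true  = outlier-change good j
            ... | false = inlier-change good j

        weightedSum-bound≤ : ∀ j → weightedSum (bound j) ≤ average-bound j
        weightedSum-bound≤ j with lookup Z j
        ... | true  = outlier-average j
        ... | false = inlier-average j

        weightedSum-change-≤ : weightedSum change ≤ sum (λ j → if C j then average-bound j else 0ℚ)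
        weightedSum-change-≤ = begin
          weightedSum change
            ≤⟨ weightedSum-mono-≤ swaps-good change-≤ ⟩
          weightedSum (λ A* A → sum (λ j → if C j then bound j A* A else 0ℚ))
            ≡⟨ weightedSum-sum (λ j A* A → if C j then bound j A* A else 0ℚ) ⟩
          sum (λ j → weightedSum (λ A* A → if C j then bound j A* A else 0ℚ))
            ≡⟨ sum-cong (λ j → weightedSum-if (C j) (bound j)) ⟩
          sum (λ j → if C j then weightedSum (bound j) else 0ℚ)
            ≤⟨ sum-mono-≤ (λ j → if-mono-≤ (C j) (weightedSum-bound≤ j)) ⟩
          sum (λ j → if C j then average-bound j else 0ℚ) ∎
          where open ≤-Reasoning

        costₚ-nonNeg : ∀ X → 0ℚ ≤ costₚ t p X
        costₚ-nonNeg X = ≤-trans (+-mono-≤ (<⇒≤ tenth-pos) (sum-nonNeg (λ j → if-nonNeg (C j) (dₚ-nonNeg j X 0≤p))))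
                                 (≤-reflexive (sym (costₚ≡ X)))
          where
            if-nonNeg : ∀ b {x} → 0ℚ ≤ x → 0ℚ ≤ (if b then x else 0ℚ)
            if-nonNeg true  0≤x = 0≤x
            if-nonNeg false _   = ≤-refl

        weightedSum-change-≥ : ∀ {k ε} → 1 ℕ.≤ k → 0ℚ ≤ ε → ∣ O ∣ ≡ k → LocallyOptimal k ℓ ε t p S →
                               - (ε * costₚ t p S) ≤ weightedSum change
        weightedSum-change-≥ {k} {ε} 1≤k 0≤ε ∣O∣≡k optimal = begin
          - (ε * cost)                                         ≡⟨ cong -_ q*k≡ε*cost ⟨
          - (q * ℕ→ℚ k)                                        ≡⟨ cong (λ n → - (q * ℕ→ℚ n)) (trans (sym ∣O∣≡k) (∣p∣≡count O)) ⟩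
          - (q * ℕ→ℚ (count (lookup O)))                       ≤⟨ neg-antimono-≤ (*-monoˡ-≤-0≤ 0≤q swapOut-size) ⟩
          - (q * weightedSum (λ A* A → ℕ→ℚ (count A)))         ≡⟨ neg-distribˡ-* q _ ⟩
          - q * weightedSum (λ A* A → ℕ→ℚ (count A))           ≡⟨ weightedSum-*ˡ (- q) (λ A* A → ℕ→ℚ (count A)) ⟨
          weightedSum (λ A* A → - q * ℕ→ℚ (count A))           ≤⟨ weightedSum-mono-≤ swaps-good not-improving ⟩
          weightedSum change                                   ∎
          where
            open ≤-Reasoning
            cost = costₚ t p S
            q = (ε * cost) ÷′ ℕ→ℚ k
            q*k≡ε*cost : q * ℕ→ℚ k ≡ ε * cost
            q*k≡ε*cost = trans (*-assoc (ε * cost) (inv (ℕ→ℚ k)) (ℕ→ℚ k))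
                               (trans (cong ((ε * cost) *_) (inv-inverseˡ (ℕ→ℚ k) (pos⇒≢0 (ℕ→ℚ-pos 1≤k)))) (*-identityʳ (ε * cost)))
            0≤q : 0ℚ ≤ q
            0≤q = *-0≤ (*-0≤ 0≤ε (costₚ-nonNeg S)) (<⇒≤ (inv-pos (ℕ→ℚ-pos 1≤k)))
            not-improving : ∀ A* A → IsGoodSwap A* A → - q * ℕ→ℚ (count A) ≤ change A* A
            not-improving A* A good = begin
              - q * ℕ→ℚ (count A)                          ≡⟨ solve 3 (λ q a c → :- q :* a := (c :- a :* q) :- c) refl q (ℕ→ℚ (count A)) cost ⟩
              (cost - ℕ→ℚ (count A) * q) - cost           ≡⟨ cong (λ n → (cost - ℕ→ℚ n * q) - cost) (∣tabulate∣≡count A) ⟨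
              (cost - ℕ→ℚ ∣ tabulate A ∣ * q) - cost      ≤⟨ +-monoˡ-≤ (- cost) (≮⇒≥ (optimal (tabulate A*) (tabulate A) (good⇒IsSwap good))) ⟩
              costₚ t p (swapped A* A) - cost             ≡⟨ change≡ A* A ⟨
              change A* A                                 ∎

        private
          X = sum (λ j → if C j then r j else 0ℚ)
          Y = sum (λ j → if C j ∧ not (lookup Z j) then ℕ→ℚ (distSet j O) else 0ℚ)
          outliers = count (λ j → C j ∧ lookup Z j)

        sum-average-bound : sum (λ j → if C j then average-bound j else 0ℚ) ≡ (1+1/ ℓ * p * ℕ→ℚ outliers + 3+2/ ℓ * Y) - X
        sum-average-bound = begin
          sum (λ j → if C j then average-bound j else 0ℚ)
            ≡⟨ sum-cong (λ j → split (C j) (lookup Z j) (r j) (ℕ→ℚ (distSet j O))) ⟩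
          sum (λ j → (L * 𝟙 (C j ∧ lookup Z j) + K * (if C j ∧ not (lookup Z j) then ℕ→ℚ (distSet j O) else 0ℚ)) - (if C j then r j else 0ℚ))
            ≡⟨ sum-sub (λ j → L * 𝟙 (C j ∧ lookup Z j) + K * (if C j ∧ not (lookup Z j) then ℕ→ℚ (distSet j O) else 0ℚ)) (λ j → if C j then r j else 0ℚ) ⟩
          sum (λ j → L * 𝟙 (C j ∧ lookup Z j) + K * (if C j ∧ not (lookup Z j) then ℕ→ℚ (distSet j O) else 0ℚ)) - X
            ≡⟨ cong (_- X) (sum-distrib-+ (λ j → L * 𝟙 (C j ∧ lookup Z j)) (λ j → K * (if C j ∧ not (lookup Z j) then ℕ→ℚ (distSet j O) else 0ℚ))) ⟩
          (sum (λ j → L * 𝟙 (C j ∧ lookup Z j)) + sum (λ j → K * (if C j ∧ not (lookup Z j) then ℕ→ℚ (distSet j O) else 0ℚ))) - X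
            ≡⟨ cong (_- X) (cong₂ _+_ (*-distribˡ-sum L (λ j → 𝟙 (C j ∧ lookup Z j))) (*-distribˡ-sum K (λ j → if C j ∧ not (lookup Z j) then ℕ→ℚ (distSet j O) else 0ℚ))) ⟨
          (L * sum (λ j → 𝟙 (C j ∧ lookup Z j)) + K * Y) - X
            ≡⟨ cong (λ x → (L * x + K * Y) - X) (sum-𝟙 (λ j → C j ∧ lookup Z j)) ⟩
          (L * ℕ→ℚ outliers + K * Y) - X ∎
          where
            open ≡-Reasoning
            L = 1+1/ ℓ * p
            K = 3+2/ ℓ
            split : ∀ c z r s → (if c then (if z then L - r else K * s - r) else 0ℚ)
                                ≡ (L * 𝟙 (c ∧ z) + K * (if c ∧ not z then s else 0ℚ)) - (if c then r else 0ℚ)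
            split true  true  r s = solve 3 (λ L K r → L :- r := (L :* con 1ℚ :+ K :* con 0ℚ) :- r) refl L K r
            split true  false r s = solve 4 (λ L K r s → K :* s :- r := (L :* con 0ℚ :+ K :* s) :- r) refl L K r s
            split false z     r s = solve 2 (λ L K → con 0ℚ := (L :* con 0ℚ :+ K :* con 0ℚ) :- con 0ℚ) refl L K

        local-search-bound : ∀ {k z ε} → 1 ℕ.≤ k → 0ℚ ≤ ε → ∣ O ∣ ≡ k → ∣ Z ∣ ℕ.≤ z → LocallyOptimal k ℓ ε t p S →
                             (1ℚ - ε) * costₚ t p S ≤ 1+1/ ℓ * p * ℕ→ℚ z + 3+2/ ℓ * outlierCost t O Z
        local-search-bound {k} {z} {ε} 1≤k 0≤ε ∣O∣≡k ∣Z∣≤z optimal = begin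
          (1ℚ - ε) * costₚ t p S                     ≡⟨ solve 2 (λ e c → (con 1ℚ :- e) :* c := c :+ :- (e :* c)) refl ε (costₚ t p S) ⟩
          costₚ t p S + - (ε * costₚ t p S)          ≤⟨ +-monoʳ-≤ (costₚ t p S) local-change ⟩
          costₚ t p S + ((L * a + K * Y) - X)        ≡⟨ cong (_+ ((L * a + K * Y) - X)) (costₚ≡ S) ⟩
          (tenth + X) + ((L * a + K * Y) - X)        ≡⟨ solve 5 (λ T X L K Y → (T :+ X) :+ ((L :+ K :* Y) :- X) := L :+ (T :+ K :* Y)) refl tenth X (L * a) K Y ⟩
          L * a + (tenth + K * Y)                    ≤⟨ +-mono-≤ (*-monoˡ-≤-0≤ 0≤L (ℕ→ℚ-mono-≤ outliers≤z)) (+-monoˡ-≤ (K * Y) (≤-*-≥1 1≤3+2/ℓ (<⇒≤ tenth-pos))) ⟩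
          L * ℕ→ℚ z + (K * tenth + K * Y)            ≡⟨ cong (λ x → L * ℕ→ℚ z + x) (sym (*-distribˡ-+ K tenth Y)) ⟩
          L * ℕ→ℚ z + K * (tenth + Y)                ≡⟨ cong (λ x → L * ℕ→ℚ z + K * x) Y≡ ⟨
          L * ℕ→ℚ z + K * outlierCost t O Z          ∎
          where
            open ≤-Reasoning
            L = 1+1/ ℓ * p
            K = 3+2/ ℓ
            a = ℕ→ℚ outliers
            local-change : - (ε * costₚ t p S) ≤ (L * a + K * Y) - X
            local-change = ≤-trans (weightedSum-change-≥ 1≤k 0≤ε ∣O∣≡k optimal) (≤-trans weightedSum-change-≤ (≤-reflexive sum-average-bound))
            0≤L : 0ℚ ≤ L
            0≤L = *-0≤ 0≤1+1/ℓ 0≤p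
            outliers≤z : outliers ℕ.≤ z
            outliers≤z = ℕₚ.≤-trans (count-mono (λ j e → Boolₚ.∧-conicalʳ (C j) _ e)) (ℕₚ.≤-trans (ℕₚ.≤-reflexive (sym (∣p∣≡count Z))) ∣Z∣≤z)
            Y≡ : outlierCost t O Z ≡ tenth + Y
            Y≡ = cong (tenth +_) (trans (sumOver≡sum (Cset t ─ Z) (λ j → ℕ→ℚ (distSet j O)))
                                        (sum-cong (λ j → cong (λ b → if b then ℕ→ℚ (distSet j O) else 0ℚ) (lookup-─ (Cset t) Z j))))

  -- The doubling step

  far-points-cost : ∀ {ℓ : ℕ} {p ε γ z far cost : ℚ} → 0ℚ ≤ p → ε < 1ℚ →
    inv (1ℚ - ε) * (1+1/ ℓ * ((1ℚ + γ) * z)) < far → p * far ≤ cost →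
    1+1/ ℓ * ((1ℚ + γ) * z) * p ≤ (1ℚ - ε) * cost
  far-points-cost {ℓ} {p} {ε} {γ} {z} {far} {cost} 0≤p ε<1 threshold<far p*far≤cost = begin
    x * p                                ≡⟨ *-identityˡ (x * p) ⟨
    1ℚ * (x * p)                         ≡⟨ cong (_* (x * p)) (inv-inverseʳ (1ℚ - ε) 1-ε≢0) ⟨
    ((1ℚ - ε) * inv (1ℚ - ε)) * (x * p)  ≡⟨ solve 4 (λ a b c p → (a :* b) :* (c :* p) := a :* ((b :* c) :* p)) refl (1ℚ - ε) (inv (1ℚ - ε)) x p ⟩
    (1ℚ - ε) * ((inv (1ℚ - ε) * x) * p)  ≤⟨ *-monoˡ-≤-0≤ 0≤1-ε (*-monoʳ-≤-0≤ 0≤p (<⇒≤ threshold<far)) ⟩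
    (1ℚ - ε) * (far * p)                 ≡⟨ cong ((1ℚ - ε) *_) (*-comm far p) ⟩
    (1ℚ - ε) * (p * far)                 ≤⟨ *-monoˡ-≤-0≤ 0≤1-ε p*far≤cost ⟩
    (1ℚ - ε) * cost                      ∎
    where
      open ≤-Reasoning
      x = 1+1/ ℓ * ((1ℚ + γ) * z)
      0≤1-ε : 0ℚ ≤ 1ℚ - ε
      0≤1-ε = p≤q⇒0≤q-p (<⇒≤ ε<1)
      1-ε≢0 : 1ℚ - ε ≢ 0ℚ
      1-ε≢0 1-ε≡0 = <-irrefl (trans (solve 1 (λ ε → ε := con 1ℚ :- (con 1ℚ :- ε)) refl ε) (trans (cong (λ y → 1ℚ - y) 1-ε≡0) (+-identityʳ 1ℚ))) ε<1

  -- Multiplying by ℓ turns 1 + 1/ℓ and 3 + 2/ℓ into ℓ + 1 and 3ℓ + 2.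
  doubling-bound : ∀ {ℓ : ℕ} {p γ z oc : ℚ} → 1 ℕ.≤ ℓ →
    1+1/ ℓ * ((1ℚ + γ) * z) * p ≤ 1+1/ ℓ * p * z + 3+2/ ℓ * oc →
    (p + p) * (γ * ((ℕ→ℚ ℓ + 1ℚ) * z)) ≤ ((1ℚ + 1ℚ) * ((1ℚ + 1ℚ + 1ℚ) * ℕ→ℚ ℓ + (1ℚ + 1ℚ))) * oc
  doubling-bound {ℓ} {p} {γ} {z} {oc} 1≤ℓ bound = begin
    (p + p) * (γ * ((L + 1ℚ) * z))                             ≡⟨ cong (λ x → (p + p) * (γ * ((L + x) * z))) (sym L*iL≡1) ⟩
    (p + p) * (γ * ((L + L * iL) * z))                          ≡⟨ solve 5 (λ p γ L iL z → (p :+ p) :* (γ :* ((L :+ L :* iL) :* z))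
                                                                            := (con 1ℚ :+ con 1ℚ) :* (L :* ((con 1ℚ :+ iL) :* γ :* z :* p))) refl p γ L iL z ⟩
    (1ℚ + 1ℚ) * (L * (1+1/ ℓ * γ * z * p))                      ≤⟨ *-monoˡ-≤-0≤ (<⇒≤ (+-mono-< 0<1 0<1)) (*-monoˡ-≤-0≤ (ℕ→ℚ-nonNeg ℓ) growth≤) ⟩
    (1ℚ + 1ℚ) * (L * (3+2/ ℓ * oc))                            ≡⟨ solve 3 (λ L iL oc → (con 1ℚ :+ con 1ℚ) :* (L :* ((con 1ℚ :+ ((con 1ℚ :+ iL) :+ (con 1ℚ :+ iL))) :* oc))
                                                                        := ((con 1ℚ :+ con 1ℚ) :* ((con 1ℚ :+ con 1ℚ :+ con 1ℚ) :* L :+ (con 1ℚ :+ con 1ℚ) :* (L :* iL))) :* oc) refl L iL oc ⟩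
    ((1ℚ + 1ℚ) * ((1ℚ + 1ℚ + 1ℚ) * L + (1ℚ + 1ℚ) * (L * iL))) * oc ≡⟨ cong (λ x → ((1ℚ + 1ℚ) * ((1ℚ + 1ℚ + 1ℚ) * L + (1ℚ + 1ℚ) * x)) * oc) L*iL≡1 ⟩
    ((1ℚ + 1ℚ) * ((1ℚ + 1ℚ + 1ℚ) * L + (1ℚ + 1ℚ) * 1ℚ)) * oc    ≡⟨ cong (λ x → ((1ℚ + 1ℚ) * ((1ℚ + 1ℚ + 1ℚ) * L + x)) * oc) (*-identityʳ (1ℚ + 1ℚ)) ⟩
    ((1ℚ + 1ℚ) * ((1ℚ + 1ℚ + 1ℚ) * L + (1ℚ + 1ℚ))) * oc         ∎
    where
      open ≤-Reasoning
      L = ℕ→ℚ ℓ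
      iL = inv L
      L*iL≡1 : L * iL ≡ 1ℚ
      L*iL≡1 = inv-inverseʳ L (pos⇒≢0 (ℕ→ℚ-pos 1≤ℓ))
      growth≤ : 1+1/ ℓ * γ * z * p ≤ 3+2/ ℓ * oc
      growth≤ = begin
        1+1/ ℓ * γ * z * p                               ≡⟨ solve 4 (λ l γ z p → l :* γ :* z :* p := l :* ((con 1ℚ :+ γ) :* z) :* p :- l :* p :* z) refl (1+1/ ℓ) γ z p ⟩
        1+1/ ℓ * ((1ℚ + γ) * z) * p - 1+1/ ℓ * p * z     ≤⟨ +-monoˡ-≤ (- (1+1/ ℓ * p * z)) bound ⟩
        (1+1/ ℓ * p * z + 3+2/ ℓ * oc) - 1+1/ ℓ * p * z  ≡⟨ solve 2 (λ a b → (a :+ b) :- a := b) refl (1+1/ ℓ * p * z) (3+2/ ℓ * oc) ⟩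
        3+2/ ℓ * oc                                      ∎

  -- The invariant of the algorithm

  module Run (ℓ : ℕ) (1≤ℓ : 1 ℕ.≤ ℓ) (γ : ℚ) (0<γ : 0ℚ < γ) (ε : ℚ) (0<ε : 0ℚ < ε) (ε<1 : ε < 1ℚ)
             {m n : ℕ} (d : Point m n → Point m n → ℕ) (pm : IsPseudometric d)
             (k z : ℕ) (1≤k : 1 ℕ.≤ k) (1≤z : 1 ℕ.≤ z) where

    open Instance d
    open Algorithm k z ℓ ε γ
    open LocalSearch d pm

    G : ℚ
    G = γ * ℕ→ℚ ((ℓ ℕ.+ 1) ℕ.* z)

    c : ℚ
    c = ℕ→ℚ (2 ℕ.* (3 ℕ.* ℓ ℕ.+ 2))

    0<G : 0ℚ < G
    0<G = *-0< 0<γ (ℕ→ℚ-pos (ℕₚ.≤-trans 1≤z (ℕₚ.m≤n*m z (ℓ ℕ.+ 1) {{ℕ.>-nonZero (ℕₚ.m≤n+m 1 ℓ)}})))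

    record Invariant (t : ℕ) (S : Subset m) (p : ℚ) : Set where
      field
        ∣S∣≡k     : ∣ S ∣ ≡ k
        0≤p       : 0ℚ ≤ p
        p-bounded : ∀ S′ O → Feasible k z t S′ O → p * G ≤ c * outlierCost t S′ O

    tenth≤outlierCost : ∀ t S O → tenth ≤ outlierCost t S O
    tenth≤outlierCost t S O = begin
      tenth                         ≡⟨ +-identityʳ tenth ⟨
      tenth + 0ℚ                    ≤⟨ +-monoʳ-≤ tenth (sum-nonNeg (λ j → if-nonNeg (lookup (Cset t ─ O) j) (distSet j S))) ⟩
      tenth + sum (λ j → if lookup (Cset t ─ O) j then ℕ→ℚ (distSet j S) else 0ℚ) ≡⟨ cong (tenth +_) (sumOver≡sum (Cset t ─ O) (λ j → ℕ→ℚ (distSet j S))) ⟨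
      outlierCost t S O             ∎
      where
        open ≤-Reasoning
        if-nonNeg : ∀ b x → 0ℚ ≤ (if b then ℕ→ℚ x else 0ℚ)
        if-nonNeg true  x = ℕ→ℚ-nonNeg x
        if-nonNeg false x = ≤-refl

    initial-invariant : ∀ S → ∣ S ∣ ≡ k → Invariant 0 S (p₀ γ z)
    initial-invariant S ∣S∣≡k = record { ∣S∣≡k = ∣S∣≡k ; 0≤p = 0≤p₀ ; p-bounded = p₀-bounded }
      where
        W : ℚ
        W = ℕ→ℚ 10 * γ * ℕ→ℚ z
        0<W : 0ℚ < W
        0<W = *-0< (*-0< (ℕ→ℚ-pos {10} (s≤s z≤n)) 0<γ) (ℕ→ℚ-pos 1≤z)
        0≤p₀ : 0ℚ ≤ p₀ γ z
        0≤p₀ = ⊓-glb (<⇒≤ (inv-pos 0<W)) (<⇒≤ tenth-pos)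
        G≡W*[ℓ+1]/10 : G ≡ W * (ℕ→ℚ (ℓ ℕ.+ 1) * tenth)
        G≡W*[ℓ+1]/10 = begin
          γ * ℕ→ℚ ((ℓ ℕ.+ 1) ℕ.* z)                      ≡⟨ cong (γ *_) (ℕ→ℚ-* (ℓ ℕ.+ 1) z) ⟩
          γ * (ℕ→ℚ (ℓ ℕ.+ 1) * ℕ→ℚ z)                    ≡⟨ *-identityʳ _ ⟨
          γ * (ℕ→ℚ (ℓ ℕ.+ 1) * ℕ→ℚ z) * (ℕ→ℚ 10 * tenth)  ≡⟨ solve 5 (λ g a b u v → g :* (a :* b) :* (u :* v) := u :* g :* b :* (a :* v)) refl γ (ℕ→ℚ (ℓ ℕ.+ 1)) (ℕ→ℚ z) (ℕ→ℚ 10) tenth ⟩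
          W * (ℕ→ℚ (ℓ ℕ.+ 1) * tenth)                    ∎
          where open ≡-Reasoning
        p₀-bounded : ∀ S′ O → Feasible k z 0 S′ O → p₀ γ z * G ≤ c * outlierCost 0 S′ O
        p₀-bounded S′ O _ = begin
          p₀ γ z * G                               ≤⟨ *-monoʳ-≤-0≤ (<⇒≤ 0<G) (p⊓q≤p (inv W) tenth) ⟩
          inv W * G                                ≡⟨ cong (inv W *_) G≡W*[ℓ+1]/10 ⟩
          inv W * (W * (ℕ→ℚ (ℓ ℕ.+ 1) * tenth))     ≡⟨ *-assoc (inv W) W _ ⟨
          (inv W * W) * (ℕ→ℚ (ℓ ℕ.+ 1) * tenth)     ≡⟨ cong (_* (ℕ→ℚ (ℓ ℕ.+ 1) * tenth)) (inv-inverseˡ W (pos⇒≢0 0<W)) ⟩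
          1ℚ * (ℕ→ℚ (ℓ ℕ.+ 1) * tenth)              ≡⟨ *-identityˡ _ ⟩
          ℕ→ℚ (ℓ ℕ.+ 1) * tenth                    ≤⟨ *-monoʳ-≤-0≤ (<⇒≤ tenth-pos) (ℕ→ℚ-mono-≤ ℓ+1≤c) ⟩
          c * tenth                                ≤⟨ *-monoˡ-≤-0≤ (ℕ→ℚ-nonNeg (2 ℕ.* (3 ℕ.* ℓ ℕ.+ 2))) (tenth≤outlierCost 0 S′ O) ⟩
          c * outlierCost 0 S′ O                   ∎
          where
            open ≤-Reasoning
            ℓ+1≤c : ℓ ℕ.+ 1 ℕ.≤ 2 ℕ.* (3 ℕ.* ℓ ℕ.+ 2)
            ℓ+1≤c = ℕₚ.≤-trans (ℕₚ.+-mono-≤ (ℕₚ.m≤n*m ℓ 3) (s≤s z≤n)) (ℕₚ.m≤n*m (3 ℕ.* ℓ ℕ.+ 2) 2)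

    private
      <ᵇ-suc : ∀ a t → (a ℕ.<ᵇ t) ≡ true → (a ℕ.<ᵇ suc t) ≡ true
      <ᵇ-suc zero    t       _ = refl
      <ᵇ-suc (suc a) (suc t) e = <ᵇ-suc a t e

      Cset-suc : ∀ t j → lookup (Cset t) j ≡ true → lookup (Cset (suc t)) j ≡ true
      Cset-suc t j j∈C = trans (Vecₚ.lookup∘tabulate _ j) (<ᵇ-suc (toℕ j) t (trans (sym (Vecₚ.lookup∘tabulate _ j)) j∈C))

      still-inlier : ∀ t O j → lookup (Cset t ─ (O ∩ Cset t)) j ≡ true → lookup (Cset (suc t) ─ O) j ≡ true
      still-inlier t O j e with lookup (Cset t) j in j∈C
      ... | true  = begin
        lookup (Cset (suc t) ─ O) j                         ≡⟨ lookup-─ (Cset (suc t)) O j ⟩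
        lookup (Cset (suc t)) j ∧ not (lookup O j)          ≡⟨ cong (_∧ not (lookup O j)) (Cset-suc t j j∈C) ⟩
        not (lookup O j)                                    ≡⟨ cong not (Boolₚ.∧-identityʳ (lookup O j)) ⟨
        true ∧ not (lookup O j ∧ true)                      ≡⟨ cong₂ (λ x y → x ∧ not (lookup O j ∧ y)) j∈C j∈C ⟨
        lookup (Cset t) j ∧ not (lookup O j ∧ lookup (Cset t) j) ≡⟨ cong (λ x → lookup (Cset t) j ∧ not x) (lookup-∩ O (Cset t) j) ⟨
        lookup (Cset t) j ∧ not (lookup (O ∩ Cset t) j)      ≡⟨ lookup-─ (Cset t) (O ∩ Cset t) j ⟨
        lookup (Cset t ─ (O ∩ Cset t)) j                     ≡⟨ e ⟩
        true                                                 ∎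
        where open ≡-Reasoning
      ... | false with () ← trans (sym (trans (lookup-─ (Cset t) (O ∩ Cset t) j) (cong (_∧ not (lookup (O ∩ Cset t) j)) j∈C))) e

    arrival-invariant : ∀ {t S p} → Invariant t S p → Invariant (suc t) S p
    arrival-invariant {t} {S} {p} inv = record { ∣S∣≡k = ∣S∣≡k ; 0≤p = 0≤p ; p-bounded = p-bounded′ }
      where
        open Invariant inv
        p-bounded′ : ∀ S′ O → Feasible k z (suc t) S′ O → p * G ≤ c * outlierCost (suc t) S′ O
        p-bounded′ S′ O (∣S′∣≡k , _ , ∣O∣≤z) = ≤-trans
          (p-bounded S′ (O ∩ Cset t) (∣S′∣≡k , p∩q⊆q O (Cset t) , ℕₚ.≤-trans (∣p∩q∣≤∣p∣ O (Cset t)) ∣O∣≤z))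
          (*-monoˡ-≤-0≤ (ℕ→ℚ-nonNeg (2 ℕ.* (3 ℕ.* ℓ ℕ.+ 2))) (+-monoʳ-≤ tenth (sumOver-mono {Cset t ─ (O ∩ Cset t)} {Cset (suc t) ─ O} (still-inlier t O) (λ j → ℕ→ℚ-nonNeg (distSet j S′)))))

    swap-invariant : ∀ {t S p A* A} → IsSwap ℓ S A* A → Invariant t S p → Invariant t (applySwap S A* A) p
    swap-invariant {S = S} {A* = A*} {A} (A⊆S , A*⊆∁S , ∣A∣≡∣A*∣ , _) inv = record
      { ∣S∣≡k = trans (∣[p∪q]─r∣≡∣p∣ S A* A A⊆S A*⊆∁S ∣A∣≡∣A*∣) (Invariant.∣S∣≡k inv)
      ; 0≤p = Invariant.0≤p inv
      ; p-bounded = Invariant.p-bounded inv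
      }

    far≤costₚ : ∀ t p S → 0ℚ ≤ p → p * ℕ→ℚ (farCount t p S) ≤ costₚ t p S
    far≤costₚ t p S 0≤p = begin
      p * ℕ→ℚ (farCount t p S)                                  ≡⟨ cong (λ x → p * ℕ→ℚ x) (countOver≡count (Cset t) far?) ⟩
      p * ℕ→ℚ (count (λ j → C j ∧ far? j))                       ≡⟨ sum-if (λ j → C j ∧ far? j) p ⟨
      sum (λ j → if C j ∧ far? j then p else 0ℚ)                ≤⟨ sum-mono-≤ (λ j → far≤dₚ (C j) j) ⟩
      sum (λ j → if C j then dₚ p j S else 0ℚ)                  ≤⟨ ≤-trans (≤-reflexive (sym (+-identityˡ _))) (+-monoˡ-≤ (sum (λ j → if C j then dₚ p j S else 0ℚ)) (<⇒≤ tenth-pos)) ⟩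
      tenth + sum (λ j → if C j then dₚ p j S else 0ℚ)          ≡⟨ cong (tenth +_) (sumOver≡sum (Cset t) (λ j → dₚ p j S)) ⟨
      costₚ t p S                                               ∎
      where
        open ≤-Reasoning
        C = lookup (Cset t)
        far? : Fin n → Bool
        far? j = ⌊ dₚ p j S ≟ p ⌋
        far≤dₚ : ∀ b j → (if b ∧ far? j then p else 0ℚ) ≤ (if b then dₚ p j S else 0ℚ)
        far≤dₚ false j = ≤-refl
        far≤dₚ true  j with dₚ p j S ≟ p
        ... | yes dₚ≡p = ≤-reflexive (sym dₚ≡p)
        ... | no _     = dₚ-nonNeg j S 0≤p

    doubling-invariant : ∀ {t S p} → NoImprovingSwap t p S → TooManyFar t p S → Invariant t S p → Invariant t S (p + p)
    doubling-invariant {t} {S} {p} no-swap too-many-far inv = record { ∣S∣≡k = ∣S∣≡k ; 0≤p = +-mono-≤ 0≤p 0≤p ; p-bounded = p-bounded′ }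
      where
        open Invariant inv
        p-bounded′ : ∀ S′ O → Feasible k z t S′ O → (p + p) * G ≤ c * outlierCost t S′ O
        p-bounded′ S′ O (∣S′∣≡k , _ , ∣O∣≤z) = begin
          (p + p) * G                                   ≡⟨ cong ((p + p) *_) G≡ ⟩
          (p + p) * (γ * ((ℕ→ℚ ℓ + 1ℚ) * ℕ→ℚ z))         ≤⟨ doubling-bound {ℓ} {p} {γ} {ℕ→ℚ z} {outlierCost t S′ O} 1≤ℓ (≤-trans far-points local-search) ⟩
          ((1ℚ + 1ℚ) * ((1ℚ + 1ℚ + 1ℚ) * ℕ→ℚ ℓ + (1ℚ + 1ℚ))) * outlierCost t S′ O ≡⟨ cong (_* outlierCost t S′ O) c≡ ⟨
          c * outlierCost t S′ O                        ∎
          where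
            open ≤-Reasoning
            G≡ : G ≡ γ * ((ℕ→ℚ ℓ + 1ℚ) * ℕ→ℚ z)
            G≡ = cong (γ *_) (trans (ℕ→ℚ-* (ℓ ℕ.+ 1) z) (cong (_* ℕ→ℚ z) (ℕ→ℚ-+ ℓ 1)))
            c≡ : c ≡ (1ℚ + 1ℚ) * ((1ℚ + 1ℚ + 1ℚ) * ℕ→ℚ ℓ + (1ℚ + 1ℚ))
            c≡ = trans (ℕ→ℚ-* 2 (3 ℕ.* ℓ ℕ.+ 2)) (cong ((1ℚ + 1ℚ) *_) (trans (ℕ→ℚ-+ (3 ℕ.* ℓ) 2) (cong (_+ (1ℚ + 1ℚ)) (ℕ→ℚ-* 3 ℓ))))
            optimal : LocallyOptimal k ℓ ε t p S
            optimal A* A swap improving = no-swap (A* , A , swap , improving)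
            S≠∅ = nonempty S (ℕₚ.≤-trans 1≤k (ℕₚ.≤-reflexive (sym ∣S∣≡k)))
            S′≠∅ = nonempty S′ (ℕₚ.≤-trans 1≤k (ℕₚ.≤-reflexive (sym ∣S′∣≡k)))
            far-points : 1+1/ ℓ * ((1ℚ + γ) * ℕ→ℚ z) * p ≤ (1ℚ - ε) * costₚ t p S
            far-points = far-points-cost {ℓ} {p} {ε} {γ} {ℕ→ℚ z} {ℕ→ℚ (farCount t p S)} {costₚ t p S} 0≤p ε<1 too-many-far (far≤costₚ t p S 0≤p)
            local-search : (1ℚ - ε) * costₚ t p S ≤ 1+1/ ℓ * p * ℕ→ℚ z + 3+2/ ℓ * outlierCost t S′ O
            local-search = Swaps.local-search-bound 0≤p ℓ 1≤ℓ S S′ S≠∅ S′≠∅ (trans ∣S∣≡k (sym ∣S′∣≡k)) t O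
                             1≤k (<⇒≤ 0<ε) ∣S′∣≡k ∣O∣≤z optimal

    StateInvariant : State → Set
    StateInvariant st = Invariant (time st) (sol st) (p st)

    invariant-cong : ∀ {t t′ S S′ p p′} → t′ ≡ t → S′ ≡ S → p′ ≡ p → Invariant t S p → Invariant t′ S′ p′
    invariant-cong refl refl refl inv = inv

    step-invariant : ∀ {s s′} → Step s s′ → StateInvariant s → StateInvariant s′
    step-invariant (inj₁ (_ , _ , _ , t≡ , S≡ , p≡)) inv =
      invariant-cong t≡ S≡ p≡ (arrival-invariant inv)
    step-invariant (inj₂ (inj₁ (_ , _ , t≡ , p≡ , (_ , _ , swap , _ , S≡)))) inv =
      invariant-cong t≡ S≡ p≡ (swap-invariant swap inv)
    step-invariant (inj₂ (inj₂ (inj₁ (_ , _ , t≡ , S≡ , no-swap , too-many-far , p≡)))) inv =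
      invariant-cong t≡ S≡ p≡ (doubling-invariant no-swap too-many-far inv)
    step-invariant (inj₂ (inj₂ (inj₂ (_ , _ , t≡ , S≡ , _ , _ , p≡)))) inv =
      invariant-cong t≡ S≡ p≡ inv

    run-invariant : ∀ {s s′} → Star Step s s′ → StateInvariant s → StateInvariant s′
    run-invariant Star.ε       inv = inv
    run-invariant (step ◅ run) inv = run-invariant run (step-invariant step inv)

    reachable-invariant : ∀ {st} → Reachable st → StateInvariant st
    reachable-invariant (st₀ , (t≡0 , ∣S∣≡k , p≡p₀ , _) , run) =
      run-invariant run (invariant-cong t≡0 refl p≡p₀ (initial-invariant (sol st₀) ∣S∣≡k))

    reachable-p≤ : ∀ {st v} → Reachable st → IsOpt k z (time st) v → p st ≤ (c * v) ÷′ G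
    reachable-p≤ {st} {v} reachable ((S , O , feasible , v≡) , _) = begin
      p st                    ≡⟨ *-identityʳ (p st) ⟨
      p st * 1ℚ               ≡⟨ cong (p st *_) (inv-inverseʳ G (pos⇒≢0 0<G)) ⟨
      p st * (G * inv G)      ≡⟨ *-assoc (p st) G (inv G) ⟨
      (p st * G) * inv G      ≤⟨ *-monoʳ-≤-0≤ (<⇒≤ (inv-pos 0<G)) (≤-trans (Invariant.p-bounded (reachable-invariant reachable) S O feasible)
                                                                          (≤-reflexive (cong (c *_) (sym v≡)))) ⟩
      (c * v) * inv G         ∎
      where open ≤-Reasoning

open import Defs
open import Data.Nat as ℕ using (ℕ; _+_)
open import Data.Fin using (Fin)
open import Data.Rational using (ℚ; 0ℚ; 1ℚ; _<_; _≤_; _*_)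
open import Data.Product using (Σ; _×_; _,_)
open import Data.Rational.Properties using (<-trans)
open Analysis using (tenth-pos; tenth<1; module Run)

lemma6 : (ℓ : ℕ) → 1 ℕ.≤ ℓ → (γ : ℚ) → 0ℚ < γ →
    Σ ℚ (λ ε₀ → (0ℚ < ε₀) × (ε₀ < 1ℚ) ×
      ((ε : ℚ) → 0ℚ < ε → ε < ε₀ →
       (m n : ℕ) (d : Point m n → Point m n → ℕ) → IsPseudometric d →
       (k z : ℕ) → 1 ℕ.≤ k → 1 ℕ.≤ z →
       (st : Instance.State d) → Instance.Algorithm.Reachable d k z ℓ ε γ st →
       (v : ℚ) → Instance.IsOpt d k z (Instance.State.time st) v →
       Instance.State.p st ≤
         (_÷′_ (ℕ→ℚ (2 ℕ.* (3 ℕ.* ℓ + 2)) * v)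
           (γ * ℕ→ℚ ((ℓ + 1) ℕ.* z)))))
-- The argument only needs ε < 1; any ε₀ < 1 would do.
lemma6 ℓ 1≤ℓ γ 0<γ = tenth , tenth-pos , tenth<1 ,
  λ ε 0<ε ε<tenth m n d pm k z 1≤k 1≤z st reachable v opt →
    Run.reachable-p≤ ℓ 1≤ℓ γ 0<γ ε 0<ε (<-trans ε<tenth tenth<1) d pm k z 1≤k 1≤z reachable opt
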